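{- Let $n\ge2$, $2\le i\le n$, $m\ge1$, let $Q=(q_{s,t})\in B^{i,m}$ be non-zero, let $k$ be the smallest row index such that row $k$ of $Q$ is non-zero, $t^Q$ the smallest column index $p$ with $q_{p,k}\ne0$, and $R$ the array obtained from $Q$ by replacing row $k$ by zeros. Let $F=f_{t^Q}^{q_{t^Q,k}}\circ f_{t^Q+1}^{\varphi_{t^Q+1}}\circ\cdots\circ f_i^{\varphi_i}$, $E=e_i^{\epsilon_i-q_{i,k}}\circ\cdots\circ e_{t^Q+1}^{\epsilon_{t^Q+1}-q_{t^Q+1,k}}$, $C(i):=E(F(R))$ and $H=f_k^{\varphi_k}\circ f_{k-1}^{\varphi_{k-1}}\circ\cdots\circ f_{i+1}^{\varphi_{i+1}}$. Then $H(C(i))=Q$.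
   Context: $B^{i,m}$ is the set of arrays $A=(a_{p,q})$ of non-negative integers indexed by $1\le p\le i$ (column index), $i\le q\le n$ (row index; row $q$ is $(a_{1,q},\dots,a_{i,q})$), with $\sum_{r=1}^n a_{\beta(r)}\le m$ for every Dyck path $\beta$ (positions $\beta(1)=(1,i),\dots,\beta(n)=(i,n)$ with $\beta(r+1)\in\{(a,b+1),(a+1,b)\}$ if $\beta(r)=(a,b)$); $a_{p,q}=0$ outside the range. Crystal operators for $\ell\in\{1,\dots,n\}$: (i) $\ell=i$: $\varphi_i(A)=m-\sum_{j=1}^{i-1}a_{j,i}-\sum_{j=i}^n a_{i,j}$, $\epsilon_i(A)=a_{i,i}$; $f_i$/$e_i$ increase/decrease $a_{i,i}$ by 1. (ii) $\ell>i$: with $T_p=\sum_{j=1}^p a_{j,\ell-1}+\sum_{j=p}^i a_{j,\ell}$ ($1\le p\le i$), $p_+$ the smallest maximizer: $\varphi_\ell(A)=\sum_{j=1}^{p_+}a_{j,\ell-1}-\sum_{j=1}^{p_+-1}a_{j,\ell}$, and $f_\ell$ decreases $a_{p_+,\ell-1}$ by 1 and increases $a_{p_+,\ell}$ by 1. (iii) $\ell<i$: with $U_p=\sum_{j=i}^p a_{\ell,j}+\sum_{j=p}^n a_{\ell+1,j}$ ($i\le p\le n$), $p_-$/$q_-$ the largest/smallest maximizer: $\varphi_\ell(A)=\sum_{j=p_- }^n a_{\ell+1,j}-\sum_{j=p_-+1}^n a_{\ell,j}$, $\epsilon_\ell(A)=\sum_{j=i}^{q_- }a_{\ell,j}-\sum_{j=i}^{q_--1}a_{\ell+1,j}$;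 $f_\ell$ increases $a_{\ell,p_- }$ by 1 and decreases $a_{\ell+1,p_- }$ by 1; $e_\ell$ decreases $a_{\ell,q_- }$ by 1 and increases $a_{\ell+1,q_- }$ by 1. $f_\ell(A)=0$ if $\varphi_\ell(A)=0$, $e_\ell(A)=0$ if $\epsilon_\ell(A)=0$. Conventions: $f_j^{\varphi_j}(B)=f_j^{\varphi_j(B)}(B)$, $e_j^{\epsilon_j-c}(B)=e_j^{\epsilon_j(B)-c}(B)$, $f_j^c$ for fixed $c$ is $c$-fold application; $\circ$ is applied right to left; empty compositions are the identity. -}

module Defs where

open import Data.Nat using (ℕ; zero; suc; _+_; _∸_; _≤_; _<_; _<ᵇ_; _≡ᵇ_)
open import Data.Bool using (Bool; true; false; if_then_else_)
open import Data.Nat.ListAction using (sum)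
open import Data.List using (List; []; _∷_; map; upTo; reverse; foldl; length; filter)
open import Data.Maybe using (Maybe; just; nothing; _>>=_)
open import Data.Product using (_×_; Σ)
open import Data.Sum using (_⊎_)
open import Relation.Binary.PropositionalEquality using (_≡_; _≢_)
open import Relation.Nullary using (¬_)

-- Arrays A = (a_{p,q}) : entry at column p, row q is  A p q.

Array : Set
Array = ℕ → ℕ → ℕ

range : ℕ → ℕ → List ℕ
range a b = map (a +_) (upTo (suc b ∸ a))

sumR : ℕ → ℕ → (ℕ → ℕ) → ℕ
sumR a b f = sum (map f (range a b))

-- Dyck paths from (1,i) to (i,n): a list of steps;
-- down : (a,b) ↦ (a,b+1),  right : (a,b) ↦ (a+1,b).

data Step : Set where
  down right : Step

endCol : ℕ → List Step → ℕ
endCol a [] = a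
endCol a (down ∷ s) = endCol a s
endCol a (right ∷ s) = endCol (suc a) s

endRow : ℕ → List Step → ℕ
endRow b [] = b
endRow b (down ∷ s) = endRow (suc b) s
endRow b (right ∷ s) = endRow b s

DyckPath : ℕ → ℕ → List Step → Set
DyckPath n i s = (endCol 1 s ≡ i) × (endRow i s ≡ n)

pathSum : Array → ℕ → ℕ → List Step → ℕ
pathSum A a b [] = A a b
pathSum A a b (down ∷ s) = A a b + pathSum A a (suc b) s
pathSum A a b (right ∷ s) = A a b + pathSum A (suc a) b s

InB : ℕ → ℕ → ℕ → Array → Set
InB n i m A =
  (∀ p q → (p ≡ 0 ⊎ i < p ⊎ q < i ⊎ n < q) → A p q ≡ 0) ×
  (∀ s → DyckPath n i s → pathSum A 1 i s ≤ m)

inc : ℕ → ℕ → Array → Array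
inc p q A p' q' = if (p ≡ᵇ p') Data.Bool.∧ (q ≡ᵇ q') then suc (A p' q') else A p' q'

dec : ℕ → ℕ → Array → Array
dec p q A p' q' = if (p ≡ᵇ p') Data.Bool.∧ (q ≡ᵇ q') then A p' q' ∸ 1 else A p' q'

smallestMax : (ℕ → ℕ) → List ℕ → ℕ
smallestMax T [] = 0
smallestMax T (x ∷ xs) = foldl (λ b y → if T b <ᵇ T y then y else b) x xs

largestMax : (ℕ → ℕ) → List ℕ → ℕ
largestMax T [] = 0
largestMax T (x ∷ xs) = foldl (λ b y → if T y <ᵇ T b then b else y) x xs

module Crystal (n i m : ℕ) where

  T : Array → ℕ → ℕ → ℕ
  T A ℓ p = sumR 1 p (λ j → A j (ℓ ∸ 1)) + sumR p i (λ j → A j ℓ)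

  p₊ : Array → ℕ → ℕ
  p₊ A ℓ = smallestMax (T A ℓ) (range 1 i)

  U : Array → ℕ → ℕ → ℕ
  U A ℓ p = sumR i p (λ j → A ℓ j) + sumR p n (λ j → A (suc ℓ) j)

  p₋ : Array → ℕ → ℕ
  p₋ A ℓ = largestMax (U A ℓ) (range i n)

  q₋ : Array → ℕ → ℕ
  q₋ A ℓ = smallestMax (U A ℓ) (range i n)

  φ : ℕ → Array → ℕ
  φ ℓ A with ℓ <ᵇ i | i <ᵇ ℓ
  ... | true  | _     = sumR (p₋ A ℓ) n (λ j → A (suc ℓ) j) ∸ sumR (suc (p₋ A ℓ)) n (λ j → A ℓ j)
  ... | false | true  = sumR 1 (p₊ A ℓ) (λ j → A j (ℓ ∸ 1)) ∸ sumR 1 (p₊ A ℓ ∸ 1) (λ j → A j ℓ)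
  ... | false | false = (m ∸ sumR 1 (i ∸ 1) (λ j → A j i)) ∸ sumR i n (λ j → A i j)

  -- ε_ℓ is only given (and only used) for ℓ ≤ i; for ℓ > i we put 0.
  ε : ℕ → Array → ℕ
  ε ℓ A with ℓ <ᵇ i | i <ᵇ ℓ
  ... | true  | _     = sumR i (q₋ A ℓ) (λ j → A ℓ j) ∸ sumR i (q₋ A ℓ ∸ 1) (λ j → A (suc ℓ) j)
  ... | false | true  = 0
  ... | false | false = A i i

  -- raw moves (without the zero test)
  fMove : ℕ → Array → Array
  fMove ℓ A with ℓ <ᵇ i | i <ᵇ ℓ
  ... | true  | _     = dec (suc ℓ) (p₋ A ℓ) (inc ℓ (p₋ A ℓ) A)
  ... | false | true  = inc (p₊ A ℓ) ℓ (dec (p₊ A ℓ) (ℓ ∸ 1) A)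
  ... | false | false = inc i i A

  eMove : ℕ → Array → Array
  eMove ℓ A with ℓ <ᵇ i | i <ᵇ ℓ
  ... | true  | _     = inc (suc ℓ) (q₋ A ℓ) (dec ℓ (q₋ A ℓ) A)
  ... | false | true  = A
  ... | false | false = dec i i A

  -- f_ℓ, e_ℓ ; nothing represents the element 0
  f : ℕ → Array → Maybe Array
  f ℓ A with φ ℓ A
  ... | zero  = nothing
  ... | suc _ = just (fMove ℓ A)

  e : ℕ → Array → Maybe Array
  e ℓ A with ε ℓ A
  ... | zero  = nothing
  ... | suc _ = just (eMove ℓ A)

  fPow : ℕ → ℕ → Array → Maybe Array
  fPow ℓ zero A = just A
  fPow ℓ (suc c) A = f ℓ A >>= fPow ℓ c

  ePow : ℕ → ℕ → Array → Maybe Array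
  ePow ℓ zero A = just A
  ePow ℓ (suc c) A = e ℓ A >>= ePow ℓ c

  -- apply steps for the indices of a list, first list element applied first
  applySeq : List ℕ → (ℕ → Array → Maybe Array) → Array → Maybe Array
  applySeq [] g A = just A
  applySeq (ℓ ∷ ls) g A = g ℓ A >>= applySeq ls g

  fMax : ℕ → Array → Maybe Array
  fMax ℓ A = fPow ℓ (φ ℓ A) A

IsFirstNonzeroRow : ℕ → ℕ → Array → ℕ → Set
IsFirstNonzeroRow n i Q k =
  (i ≤ k) × (k ≤ n) ×
  (¬ (∀ p → 1 ≤ p → p ≤ i → Q p k ≡ 0)) ×
  (∀ q → i ≤ q → q < k → ∀ p → 1 ≤ p → p ≤ i → Q p q ≡ 0)

IsFirstNonzeroCol : ℕ → Array → ℕ → ℕ → Set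
IsFirstNonzeroCol i Q k t =
  (1 ≤ t) × (t ≤ i) × (Q t k ≢ 0) × (∀ p → 1 ≤ p → p < t → Q p k ≡ 0)

zeroRow : ℕ → Array → Array
zeroRow k Q p q = if q ≡ᵇ k then 0 else Q p q

module Construction (n i m : ℕ) (Q : Array) (k t : ℕ) where
  open Crystal n i m

  R : Array
  R = zeroRow k Q

  F : Array → Maybe Array
  F A = applySeq (reverse (range (suc t) i)) fMax A >>= fPow t (Q t k)

  E : Array → Maybe Array
  E A = applySeq (range (suc t) i) (λ ℓ B → ePow ℓ (ε ℓ B ∸ Q ℓ k) B) A

  C : Maybe Array
  C = F R >>= E

  H : Array → Maybe Array
  H A = applySeq (range (suc i) k) fMax A

module Submission where

-- Let R be Q with row k erased and c row k of Q.  The composite E ∘ F turns R into R with row i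
-- replaced by c; every f_ℓ^{φ_ℓ} of H then shifts this row one step down, the rows strictly between
-- i and k being zero.
--
-- For ℓ < i view an array as its row i (the head) above rows i + 1, …, n (the tail), and let M be the
-- maximum of U_p over the tail.  While the head value of U exceeds M the maximiser is p = i, so
-- f_ℓ^{φ_ℓ} first moves m − M units inside the head and then fills column ℓ of the tail.  A move at the
-- last maximiser turns it into the first maximiser with the same maximum, so e_ℓ^{ε_ℓ − c_ℓ} undoes the
-- tail moves before it moves units back inside the head, leaving c_ℓ there.  This needs
-- M + c_1 + ⋯ + c_ℓ ≤ m, which is the Dyck path condition for paths running down column 1 to row k,
-- along row k to column ℓ, and then down the tail; the tail moves preserve these bounds.

open import Defs
open import Data.Nat hiding (_^_)
open import Data.Nat.Properties
open import Data.Nat.ListAction using (sum)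
open import Data.Nat.ListAction.Properties using (sum-++)
open import Data.List using (List; []; _∷_; _++_; [_]; map; upTo; applyUpTo; foldl; reverse; replicate)
open import Data.List.Properties using (map-upTo; map-applyUpTo; map-cong; map-++; upTo-∷ʳ; map-cong-local; foldl-++; reverse-++)
open import Data.List.Relation.Unary.All as All using (All; []; _∷_)
import Data.List.Relation.Unary.All.Properties as All
open import Data.List.Extrema.Nat using (max; xs≤max; max≤v⁺)
open import Data.Empty using (⊥; ⊥-elim)
open import Data.Nat.Solver using (module +-*-Solver)
open +-*-Solver using (solve; _:+_; _:=_)
open import Function using (_∘_)
open import Function.Endo.Propositional Array using (_^_)
open import Relation.Binary.PropositionalEquality hiding ([_])
open import Relation.Nullary using (¬_; Dec; yes; no)
open import Relation.Nullary.Reflects using (ofʸ; ofⁿ)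
open import Relation.Binary.Definitions using (tri<; tri≈; tri>)
open import Data.Bool using (true; false; if_then_else_; T)
open import Data.Bool.Properties using (∧-comm)
open import Data.Sum using (_⊎_; inj₁; inj₂; [_,_]′)
open import Data.Product using (Σ; _×_; _,_; proj₁; proj₂)
open import Data.Maybe using (Maybe; just; nothing; _>>=_)
open import Data.Maybe.Relation.Binary.Pointwise as Pointwise using (Pointwise; just; nothing)
open import Algebra.Properties.CommutativeSemigroup +-commutativeSemigroup using (x∙yz≈y∙xz)

suc[m∸1]≡m : ∀ {m} → 0 < m → suc (m ∸ 1) ≡ m
suc[m∸1]≡m {suc m} _ = refl

m+n≡o∧n<o⇒0<m : ∀ {m n o} → m + n ≡ o → n < o → 0 < m
m+n≡o∧n<o⇒0<m {zero}  refl n<o = ⊥-elim (<-irrefl refl n<o)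
m+n≡o∧n<o⇒0<m {suc m} _    _   = z<s

m∸n∸1≡m∸[1+n] : ∀ m n → m ∸ n ∸ 1 ≡ m ∸ suc n
m∸n∸1≡m∸[1+n] m n = trans (∸-+-assoc m n 1) (cong (m ∸_) (+-comm n 1))

≤-suc-cases : ∀ {A : Set} {q b} → q ≤ suc b → (q ≤ b → A) → (q ≡ suc b → A) → A
≤-suc-cases q≤1+b below at with m≤n⇒m<n∨m≡n q≤1+b
... | inj₁ (s≤s q≤b) = below q≤b
... | inj₂ q≡1+b     = at q≡1+b

-- Intervals and interval sums

range-cons : ∀ {a b} → a ≤ b → range a b ≡ a ∷ range (suc a) b
range-cons {a} {b} a≤b = begin
  map (a +_) (upTo (suc b ∸ a))                ≡⟨ cong (map (a +_) ∘ upTo) (+-∸-assoc 1 a≤b) ⟩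
  a + 0 ∷ map (a +_) (applyUpTo suc (b ∸ a))  ≡⟨ cong₂ _∷_ (+-identityʳ a) shift ⟩
  a ∷ range (suc a) b                          ∎
  where
  open ≡-Reasoning
  shift : map (a +_) (applyUpTo suc (b ∸ a)) ≡ map (suc a +_) (upTo (b ∸ a))
  shift = trans (map-applyUpTo suc (a +_) (b ∸ a))
         (trans (sym (map-upTo ((a +_) ∘ suc) (b ∸ a))) (map-cong (+-suc a) (upTo (b ∸ a))))

range-nil : ∀ {a b} → b < a → range a b ≡ []
range-nil {a} {b} b<a = cong (map (a +_) ∘ upTo) (m≤n⇒m∸n≡0 b<a)

range-snoc : ∀ {a b} → a ≤ suc b → range a (suc b) ≡ range a b ++ [ suc b ]
range-snoc {a} {b} a≤1+b = begin
  map (a +_) (upTo (suc (suc b) ∸ a))             ≡⟨ cong (map (a +_) ∘ upTo) (+-∸-assoc 1 a≤1+b) ⟩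
  map (a +_) (upTo (suc (suc b ∸ a)))             ≡⟨ cong (map (a +_)) (sym (upTo-∷ʳ (suc b ∸ a))) ⟩
  map (a +_) (upTo (suc b ∸ a) ++ [ suc b ∸ a ])  ≡⟨ map-++ (a +_) (upTo (suc b ∸ a)) _ ⟩
  range a b ++ [ a + (suc b ∸ a) ]                 ≡⟨ cong (λ x → range a b ++ [ x ]) (m+[n∸m]≡n a≤1+b) ⟩
  range a b ++ [ suc b ]                           ∎
  where open ≡-Reasoning

All-range⁺ : ∀ {P : ℕ → Set} {a b} → (∀ j → a ≤ j → j ≤ b → P j) → All P (range a b)
All-range⁺ {P} {a} {b} h = All.map⁺ (All.applyUpTo⁺₁ (λ j → j) (suc b ∸ a) inside)
  where
  inside : ∀ {j} → j < suc b ∸ a → P (a + j)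
  inside {j} j<L = h (a + j) (m≤m+n a j) (≤-pred (subst (_≤ suc b) (cong suc (+-comm j a)) a+j<1+b))
    where
    a+j<1+b : suc j + a ≤ suc b
    a+j<1+b = m≤o∸n⇒m+n≤o (suc j) (<⇒≤ (m∸n≢0⇒n<m (m<n⇒n≢0 j<L))) j<L

All-range⁻ : ∀ {P : ℕ → Set} {a b} → All P (range a b) → ∀ j → a ≤ j → j ≤ b → P j
All-range⁻ {P} {a} {b} h j a≤j j≤b =
  subst P (m+[n∸m]≡n a≤j) (All.applyUpTo⁻ (λ j → j) (suc b ∸ a) (All.map⁻ h) (∸-monoˡ-< (s≤s j≤b) a≤j))

sum-mono-local : ∀ {f g : ℕ → ℕ} {xs} → All (λ x → f x ≤ g x) xs → sum (map f xs) ≤ sum (map g xs)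
sum-mono-local []       = z≤n
sum-mono-local (h ∷ hs) = +-mono-≤ h (sum-mono-local hs)

sumR-cong : ∀ a b {f g} → (∀ j → a ≤ j → j ≤ b → f j ≡ g j) → sumR a b f ≡ sumR a b g
sumR-cong a b h = cong sum (map-cong-local (All-range⁺ h))

sumR-mono : ∀ a b {f g} → (∀ j → a ≤ j → j ≤ b → f j ≤ g j) → sumR a b f ≤ sumR a b g
sumR-mono a b h = sum-mono-local (All-range⁺ h)

sumR-zero : ∀ a b {f} → (∀ j → a ≤ j → j ≤ b → f j ≡ 0) → sumR a b f ≡ 0
sumR-zero a b h = trans (sumR-cong a b h) (zeros (range a b))
  where
  zeros : ∀ xs → sum (map (λ _ → 0) xs) ≡ 0
  zeros []       = refl
  zeros (_ ∷ xs) = zeros xs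

sumR-empty : ∀ {a b} f → b < a → sumR a b f ≡ 0
sumR-empty f b<a = cong (sum ∘ map f) (range-nil b<a)

sumR-cons : ∀ {a b} f → a ≤ b → sumR a b f ≡ f a + sumR (suc a) b f
sumR-cons f a≤b = cong (sum ∘ map f) (range-cons a≤b)

sumR-snoc : ∀ {a b} f → a ≤ suc b → sumR a (suc b) f ≡ sumR a b f + f (suc b)
sumR-snoc {a} {b} f a≤1+b = begin
  sum (map f (range a (suc b)))                   ≡⟨ cong (sum ∘ map f) (range-snoc a≤1+b) ⟩
  sum (map f (range a b ++ [ suc b ]))            ≡⟨ cong sum (map-++ f (range a b) [ suc b ]) ⟩
  sum (map f (range a b) ++ [ f (suc b) ])        ≡⟨ sum-++ (map f (range a b)) [ f (suc b) ] ⟩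
  sumR a b f + (f (suc b) + 0)                     ≡⟨ cong (sumR a b f +_) (+-identityʳ (f (suc b))) ⟩
  sumR a b f + f (suc b)                           ∎
  where open ≡-Reasoning

sumR-single : ∀ a f → sumR a a f ≡ f a
sumR-single a f = trans (sumR-cons f ≤-refl) (trans (cong (f a +_) (sumR-empty f (n<1+n a))) (+-identityʳ (f a)))

sumR-split : ∀ {a c b} f → a ≤ suc c → c ≤ b → sumR a b f ≡ sumR a c f + sumR (suc c) b f
sumR-split {a} {c} {b} f a≤1+c c≤b with m≤n⇒m<n∨m≡n c≤b
... | inj₂ refl = sym (trans (cong (sumR a c f +_) (sumR-empty f (n<1+n c))) (+-identityʳ _))
sumR-split {a} {c} {suc b} f a≤1+c c≤b | inj₁ (s≤s c≤b′) = begin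
  sumR a (suc b) f                             ≡⟨ sumR-snoc f (≤-trans a≤1+c (s≤s c≤b′)) ⟩
  sumR a b f + f (suc b)                       ≡⟨ cong (_+ f (suc b)) (sumR-split f a≤1+c c≤b′) ⟩
  sumR a c f + sumR (suc c) b f + f (suc b)    ≡⟨ +-assoc (sumR a c f) _ _ ⟩
  sumR a c f + (sumR (suc c) b f + f (suc b))  ≡⟨ cong (sumR a c f +_) (sym (sumR-snoc f (s≤s c≤b′))) ⟩
  sumR a c f + sumR (suc c) (suc b) f          ∎
  where open ≡-Reasoning

≡ᵇ-refl : ∀ n → (n ≡ᵇ n) ≡ true
≡ᵇ-refl zero    = refl
≡ᵇ-refl (suc n) = ≡ᵇ-refl n

≡ᵇ-false : ∀ {m n} → m ≢ n → (m ≡ᵇ n) ≡ false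
≡ᵇ-false {m} {n} m≢n with m ≡ᵇ n in eq
... | false = refl
... | true  = ⊥-elim (m≢n (≡ᵇ⇒≡ m n (subst T (sym eq) _)))

setAt : (ℕ → ℕ) → ℕ → ℕ → (ℕ → ℕ)
setAt x c v j = if j ≡ᵇ c then v else x j

setAt-at : ∀ x c v → setAt x c v c ≡ v
setAt-at x c v rewrite ≡ᵇ-refl c = refl

setAt-off : ∀ x {c j} v → j ≢ c → setAt x c v j ≡ x j
setAt-off x v j≢c rewrite ≡ᵇ-false j≢c = refl

setAt-same : ∀ x c j → setAt x c (x c) j ≡ x j
setAt-same x c j with j ≟ c
... | yes refl = setAt-at x j (x j)
... | no j≢c   = setAt-off x (x c) j≢c

sumR-remove : ∀ {a b p} h → a ≤ p → p ≤ b → sumR a b h ≡ h p + sumR a b (setAt h p 0)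
sumR-remove {b = b} {p = zero} h z≤n _ =
  trans (sumR-cons {b = b} h z≤n) (cong (h 0 +_) (trans (sumR-cong 1 b away) (sym (sumR-cons {b = b} (setAt h 0 0) z≤n))))
  where
  away : ∀ j → 1 ≤ j → j ≤ b → h j ≡ setAt h 0 0 j
  away j 1≤j _ = sym (setAt-off h 0 (>⇒≢ 1≤j))
sumR-remove {a} {b} {suc p} h a≤p p≤b = begin
  sumR a b h                                   ≡⟨ around h ⟩
  sumR a p h + (h (suc p) + sumR (2 + p) b h)  ≡⟨ x∙yz≈y∙xz (sumR a p h) (h (suc p)) (sumR (2 + p) b h) ⟩
  h (suc p) + (sumR a p h + sumR (2 + p) b h)  ≡⟨ cong (h (suc p) +_) (cong₂ _+_ (sumR-cong a p below) (sumR-cong (2 + p) b above)) ⟩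
  h (suc p) + (sumR a p π + (0 + sumR (2 + p) b π))
    ≡⟨ cong (λ x → h (suc p) + (sumR a p π + (x + sumR (2 + p) b π))) (sym (setAt-at h (suc p) 0)) ⟩
  h (suc p) + (sumR a p π + (π (suc p) + sumR (2 + p) b π))  ≡⟨ cong (h (suc p) +_) (sym (around π)) ⟩
  h (suc p) + sumR a b π                       ∎
  where
  open ≡-Reasoning
  π : ℕ → ℕ
  π = setAt h (suc p) 0
  around : ∀ f → sumR a b f ≡ sumR a p f + (f (suc p) + sumR (2 + p) b f)
  around f = trans (sumR-split f a≤p (≤-trans (n≤1+n p) p≤b)) (cong (sumR a p f +_) (sumR-cons f p≤b))
  below : ∀ j → a ≤ j → j ≤ p → h j ≡ π j
  below j _ j≤p = sym (setAt-off h 0 (<⇒≢ (s≤s j≤p)))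
  above : ∀ j → 2 + p ≤ j → j ≤ b → h j ≡ π j
  above j 2+p≤j _ = sym (setAt-off h 0 (>⇒≢ 2+p≤j))

sumR-suc-at : ∀ {a b p} f g → a ≤ p → p ≤ b → g p ≡ suc (f p) → (∀ j → j ≢ p → g j ≡ f j) →
              sumR a b g ≡ suc (sumR a b f)
sumR-suc-at {a} {b} {p} f g a≤p p≤b gp rest = begin
  sumR a b g                               ≡⟨ sumR-remove g a≤p p≤b ⟩
  g p + sumR a b (setAt g p 0)            ≡⟨ cong₂ _+_ gp (sumR-cong a b same) ⟩
  suc (f p + sumR a b (setAt f p 0))      ≡⟨ cong suc (sym (sumR-remove f a≤p p≤b)) ⟩
  suc (sumR a b f)                         ∎
  where
  open ≡-Reasoning
  same : ∀ j → a ≤ j → j ≤ b → setAt g p 0 j ≡ setAt f p 0 j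
  same j _ _ with j ≟ p
  ... | yes refl = trans (setAt-at g p 0) (sym (setAt-at f p 0))
  ... | no j≢p   = trans (setAt-off g 0 j≢p) (trans (rest j j≢p) (sym (setAt-off f 0 j≢p)))

sumR-outside : ∀ a b {p} f g → (∀ j → j ≢ p → g j ≡ f j) → b < p ⊎ p < a → sumR a b g ≡ sumR a b f
sumR-outside a b f g rest out = sumR-cong a b (λ j a≤j j≤b → rest j (λ { refl → away out a≤j j≤b }))
  where
  away : ∀ {a b p} → b < p ⊎ p < a → a ≤ p → p ≤ b → ⊥
  away (inj₁ b<p) _   p≤b = <⇒≱ b<p p≤b
  away (inj₂ p<a) a≤p _   = <⇒≱ p<a a≤p

m≤sumR : ∀ {a b j} f → a ≤ j → j ≤ b → f j ≤ sumR a b f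
m≤sumR f a≤j j≤b = subst (f _ ≤_) (sym (sumR-remove f a≤j j≤b)) (m≤m+n _ _)

sumR≡0⇒ : ∀ {a b} f → sumR a b f ≡ 0 → ∀ j → a ≤ j → j ≤ b → f j ≡ 0
sumR≡0⇒ f sum≡0 j a≤j j≤b = n≤0⇒n≡0 (subst (f j ≤_) sum≡0 (m≤sumR f a≤j j≤b))

maxR : (ℕ → ℕ) → ℕ → ℕ → ℕ
maxR f a b = max 0 (map f (range a b))

maxR-ub : ∀ {a b q} f → a ≤ q → q ≤ b → f q ≤ maxR f a b
maxR-ub {a} {b} f = All-range⁻ (All.map⁻ (xs≤max 0 (map f (range a b)))) _

maxR-lub : ∀ {a b B} f → (∀ q → a ≤ q → q ≤ b → f q ≤ B) → maxR f a b ≤ B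
maxR-lub f h = max≤v⁺ z≤n (All.map⁺ (All-range⁺ h))

maxR-empty : ∀ {a b} f → b < a → maxR f a b ≡ 0
maxR-empty f b<a = cong (max 0 ∘ map f) (range-nil b<a)

-- Maximisers

record IsLastMax (f : ℕ → ℕ) (a b p : ℕ) : Set where
  constructor lastMax
  field
    lower   : a ≤ p
    upper   : p ≤ b
    maximal : ∀ q → a ≤ q → q ≤ b → f q ≤ f p
    beyond  : ∀ q → p < q → q ≤ b → f q < f p

record IsFirstMax (f : ℕ → ℕ) (a b p : ℕ) : Set where
  constructor firstMax
  field
    lower   : a ≤ p
    upper   : p ≤ b
    maximal : ∀ q → a ≤ q → q ≤ b → f q ≤ f p
    before  : ∀ q → a ≤ q → q < p → f q < f p

module _ (f : ℕ → ℕ) where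

  lastStep firstStep : ℕ → ℕ → ℕ
  lastStep  p q = if f q <ᵇ f p then p else q
  firstStep p q = if f p <ᵇ f q then q else p

  IsLastMax-single : ∀ a → IsLastMax f a a a
  IsLastMax-single a = lastMax ≤-refl ≤-refl (λ q a≤q q≤a → ≤-reflexive (cong f (≤-antisym q≤a a≤q)))
                               (λ q a<q q≤a → ⊥-elim (<⇒≱ a<q q≤a))

  IsFirstMax-single : ∀ a → IsFirstMax f a a a
  IsFirstMax-single a = firstMax ≤-refl ≤-refl (λ q a≤q q≤a → ≤-reflexive (cong f (≤-antisym q≤a a≤q)))
                                 (λ q a≤q q<a → ⊥-elim (<⇒≱ q<a a≤q))

  IsLastMax-step : ∀ {a b p} → IsLastMax f a b p → IsLastMax f a (suc b) (lastStep p (suc b))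
  IsLastMax-step {a} {b} {p} (lastMax a≤p p≤b maximal beyond)
    with f (suc b) <ᵇ f p | <ᵇ-reflects-< (f (suc b)) (f p)
  ... | true  | ofʸ new<p = lastMax a≤p (m≤n⇒m≤1+n p≤b)
    (λ q a≤q q≤1+b → ≤-suc-cases q≤1+b (maximal q a≤q) (λ { refl → <⇒≤ new<p }))
    (λ q p<q q≤1+b → ≤-suc-cases q≤1+b (beyond q p<q) (λ { refl → new<p }))
  ... | false | ofⁿ new≮p = lastMax (≤-trans a≤p (m≤n⇒m≤1+n p≤b)) ≤-refl
    (λ q a≤q q≤1+b → ≤-suc-cases q≤1+b (λ q≤b → ≤-trans (maximal q a≤q q≤b) (≮⇒≥ new≮p)) (λ { refl → ≤-refl }))
    (λ q b<q q≤1+b → ⊥-elim (<⇒≱ b<q q≤1+b))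

  IsFirstMax-step : ∀ {a b p} → IsFirstMax f a b p → IsFirstMax f a (suc b) (firstStep p (suc b))
  IsFirstMax-step {a} {b} {p} (firstMax a≤p p≤b maximal before)
    with f p <ᵇ f (suc b) | <ᵇ-reflects-< (f p) (f (suc b))
  ... | true  | ofʸ p<new = firstMax (≤-trans a≤p (m≤n⇒m≤1+n p≤b)) ≤-refl
    (λ q a≤q q≤1+b → ≤-suc-cases q≤1+b (λ q≤b → ≤-trans (maximal q a≤q q≤b) (<⇒≤ p<new)) (λ { refl → ≤-refl }))
    (λ q a≤q q<1+b → <-≤-trans (s≤s (maximal q a≤q (≤-pred q<1+b))) p<new)
  ... | false | ofⁿ p≮new = firstMax a≤p (m≤n⇒m≤1+n p≤b)
    (λ q a≤q q≤1+b → ≤-suc-cases q≤1+b (maximal q a≤q) (λ { refl → ≮⇒≥ p≮new }))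
    before

  largestMax-correct : ∀ {a b} → a ≤ b → IsLastMax f a b (largestMax f (range a b))
  largestMax-correct {a} {b} a≤b rewrite range-cons a≤b = go b a≤b
    where
    go : ∀ b → a ≤ b → IsLastMax f a b (foldl lastStep a (range (suc a) b))
    go b a≤b with m≤n⇒m<n∨m≡n a≤b
    ... | inj₂ refl rewrite range-nil (n<1+n a) = IsLastMax-single a
    go (suc b) _ | inj₁ (s≤s a≤b)
      rewrite range-snoc (s≤s a≤b) | foldl-++ lastStep a (range (suc a) b) [ suc b ] = IsLastMax-step (go b a≤b)

  smallestMax-correct : ∀ {a b} → a ≤ b → IsFirstMax f a b (smallestMax f (range a b))
  smallestMax-correct {a} {b} a≤b rewrite range-cons a≤b = go b a≤b
    where
    go : ∀ b → a ≤ b → IsFirstMax f a b (foldl firstStep a (range (suc a) b))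
    go b a≤b with m≤n⇒m<n∨m≡n a≤b
    ... | inj₂ refl rewrite range-nil (n<1+n a) = IsFirstMax-single a
    go (suc b) _ | inj₁ (s≤s a≤b)
      rewrite range-snoc (s≤s a≤b) | foldl-++ firstStep a (range (suc a) b) [ suc b ] = IsFirstMax-step (go b a≤b)

module _ {f : ℕ → ℕ} {a b : ℕ} where

  IsLastMax-unique : ∀ {p p′} → IsLastMax f a b p → IsLastMax f a b p′ → p ≡ p′
  IsLastMax-unique {p} {p′} (lastMax a≤p p≤b maximal beyond) (lastMax a≤p′ p′≤b maximal′ beyond′) with <-cmp p p′
  ... | tri≈ _ p≡p′ _ = p≡p′
  ... | tri< p<p′ _ _ = ⊥-elim (<⇒≱ (beyond p′ p<p′ p′≤b) (maximal′ p a≤p p≤b))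
  ... | tri> _ _ p′<p = ⊥-elim (<⇒≱ (beyond′ p p′<p p≤b) (maximal p′ a≤p′ p′≤b))

  IsFirstMax-unique : ∀ {p p′} → IsFirstMax f a b p → IsFirstMax f a b p′ → p ≡ p′
  IsFirstMax-unique {p} {p′} (firstMax a≤p p≤b maximal before) (firstMax a≤p′ p′≤b maximal′ before′) with <-cmp p p′
  ... | tri≈ _ p≡p′ _ = p≡p′
  ... | tri< p<p′ _ _ = ⊥-elim (<⇒≱ (before′ p a≤p p<p′) (maximal p′ a≤p′ p′≤b))
  ... | tri> _ _ p′<p = ⊥-elim (<⇒≱ (before p′ a≤p′ p′<p) (maximal′ p a≤p p≤b))

  largestMax≡ : ∀ {p} → a ≤ b → IsLastMax f a b p → largestMax f (range a b) ≡ p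
  largestMax≡ a≤b = IsLastMax-unique (largestMax-correct f a≤b)

  smallestMax≡ : ∀ {p} → a ≤ b → IsFirstMax f a b p → smallestMax f (range a b) ≡ p
  smallestMax≡ a≤b = IsFirstMax-unique (smallestMax-correct f a≤b)

  lastMax-firstMax-value : ∀ {p p′} → IsLastMax f a b p → IsFirstMax f a b p′ → f p ≡ f p′
  lastMax-firstMax-value (lastMax a≤p p≤b maximal _) (firstMax a≤p′ p′≤b maximal′ _) =
    ≤-antisym (maximal′ _ a≤p p≤b) (maximal _ a≤p′ p′≤b)

IsLastMax-resp : ∀ {f g a b p} → (∀ q → a ≤ q → q ≤ b → f q ≡ g q) → IsLastMax f a b p → IsLastMax g a b p
IsLastMax-resp {f} {g} {p = p} f≗g (lastMax a≤p p≤b maximal beyond) = lastMax a≤p p≤b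
  (λ q a≤q q≤b → subst₂ _≤_ (f≗g q a≤q q≤b) (f≗g p a≤p p≤b) (maximal q a≤q q≤b))
  (λ q p<q q≤b → subst₂ _<_ (f≗g q (≤-trans a≤p (<⇒≤ p<q)) q≤b) (f≗g p a≤p p≤b) (beyond q p<q q≤b))

largestMax-cong : ∀ {f g} → (∀ x → f x ≡ g x) → ∀ xs → largestMax f xs ≡ largestMax g xs
largestMax-cong f≗g []       = refl
largestMax-cong {f} {g} f≗g (x ∷ xs) = go x xs
  where
  go : ∀ acc xs → foldl (lastStep f) acc xs ≡ foldl (lastStep g) acc xs
  go acc []       = refl
  go acc (y ∷ ys) rewrite f≗g y | f≗g acc = go _ ys

smallestMax-cong : ∀ {f g} → (∀ x → f x ≡ g x) → ∀ xs → smallestMax f xs ≡ smallestMax g xs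
smallestMax-cong f≗g []       = refl
smallestMax-cong {f} {g} f≗g (x ∷ xs) = go x xs
  where
  go : ∀ acc xs → foldl (firstStep f) acc xs ≡ foldl (firstStep g) acc xs
  go acc []       = refl
  go acc (y ∷ ys) rewrite f≗g y | f≗g acc = go _ ys

-- Arrays up to pointwise equality

infix 4 _≈_ _≋_ _⇓_

_≈_ : Array → Array → Set
A ≈ B = ∀ p q → A p q ≡ B p q

≈-refl : ∀ {A} → A ≈ A
≈-refl p q = refl

≈-trans : ∀ {A B C} → A ≈ B → B ≈ C → A ≈ C
≈-trans A≈B B≈C p q = trans (A≈B p q) (B≈C p q)

≡⇒≈ : ∀ {A B} → A ≡ B → A ≈ B
≡⇒≈ refl = ≈-refl

_≋_ : Maybe Array → Maybe Array → Set
_≋_ = Pointwise _≈_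

≋-trans : ∀ {X Y Z} → X ≋ Y → Y ≋ Z → X ≋ Z
≋-trans = Pointwise.trans ≈-trans

_⇓_ : Maybe Array → Array → Set
X ⇓ B = X ≋ just B

Respects≈ : (Array → Maybe Array) → Set
Respects≈ g = ∀ {A B} → A ≈ B → g A ≋ g B

>>=-resp : ∀ {X Y g} → X ≋ Y → Respects≈ g → (X >>= g) ≋ (Y >>= g)
>>=-resp nothing     _    = nothing
>>=-resp (just A≈B) resp = resp A≈B

>>=-⇓ : ∀ {X Y Z g} → X ⇓ Y → Respects≈ g → g Y ⇓ Z → (X >>= g) ⇓ Z
>>=-⇓ X⇓Y resp gY⇓Z = ≋-trans (>>=-resp X⇓Y resp) gY⇓Z

⇓-≈ : ∀ {X A B} → X ⇓ A → A ≈ B → X ⇓ B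
⇓-≈ X⇓A A≈B = ≋-trans X⇓A (just A≈B)

⇓⇒≡just : ∀ {X B} → X ⇓ B → Σ Array (λ A → (X ≡ just A) × A ≈ B)
⇓⇒≡just (just A≈B) = _ , refl , A≈B

bind-assoc : ∀ (X : Maybe Array) (g h : Array → Maybe Array) → ((X >>= g) >>= h) ≡ (X >>= (λ A → g A >>= h))
bind-assoc nothing  g h = refl
bind-assoc (just A) g h = refl

bind-cong : ∀ (X : Maybe Array) {g h : Array → Maybe Array} → (∀ A → g A ≡ h A) → (X >>= g) ≡ (X >>= h)
bind-cong nothing  g≗h = refl
bind-cong (just A) g≗h = g≗h A

bind-just : ∀ (X : Maybe Array) → (X >>= just) ≡ X
bind-just nothing  = refl
bind-just (just A) = refl

inc-here : ∀ c p A → inc c p A c p ≡ suc (A c p)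
inc-here c p A rewrite ≡ᵇ-refl c | ≡ᵇ-refl p = refl

inc-col : ∀ {c c′} p A q → c ≢ c′ → inc c p A c′ q ≡ A c′ q
inc-col p A q c≢c′ rewrite ≡ᵇ-false c≢c′ = refl

inc-row : ∀ c {p q} A c′ → p ≢ q → inc c p A c′ q ≡ A c′ q
inc-row c A c′ p≢q rewrite ≡ᵇ-false p≢q with c ≡ᵇ c′
... | true  = refl
... | false = refl

dec-here : ∀ c p A → dec c p A c p ≡ A c p ∸ 1
dec-here c p A rewrite ≡ᵇ-refl c | ≡ᵇ-refl p = refl

dec-col : ∀ {c c′} p A q → c ≢ c′ → dec c p A c′ q ≡ A c′ q
dec-col p A q c≢c′ rewrite ≡ᵇ-false c≢c′ = refl

dec-row : ∀ c {p q} A c′ → p ≢ q → dec c p A c′ q ≡ A c′ q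
dec-row c A c′ p≢q rewrite ≡ᵇ-false p≢q with c ≡ᵇ c′
... | true  = refl
... | false = refl

inc-local : ∀ c p {A B c′ q} → A c′ q ≡ B c′ q → inc c p A c′ q ≡ inc c p B c′ q
inc-local c p {c′ = c′} {q} A≡B rewrite A≡B = refl

dec-local : ∀ c p {A B c′ q} → A c′ q ≡ B c′ q → dec c p A c′ q ≡ dec c p B c′ q
dec-local c p {c′ = c′} {q} A≡B rewrite A≡B = refl

inc-cong : ∀ c p {A B} → A ≈ B → inc c p A ≈ inc c p B
inc-cong c p {A} {B} A≈B p′ q′ = inc-local c p {A} {B} (A≈B p′ q′)

dec-cong : ∀ c p {A B} → A ≈ B → dec c p A ≈ dec c p B
dec-cong c p {A} {B} A≈B p′ q′ = dec-local c p {A} {B} (A≈B p′ q′)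

-- The crystal operators respect pointwise equality

<ᵇ-true : ∀ {m n} → m < n → (m <ᵇ n) ≡ true
<ᵇ-true {m} {n} m<n with m <ᵇ n | <ᵇ-reflects-< m n
... | true  | _        = refl
... | false | ofⁿ m≮n = ⊥-elim (m≮n m<n)

<ᵇ-false : ∀ {m n} → ¬ m < n → (m <ᵇ n) ≡ false
<ᵇ-false {m} {n} m≮n with m <ᵇ n | <ᵇ-reflects-< m n
... | true  | ofʸ m<n = ⊥-elim (m≮n m<n)
... | false | _       = refl

module Operators (n i m : ℕ) where
  open Crystal n i m

  private
    rowSum-cong : ∀ {A B} → A ≈ B → ∀ a b c → sumR a b (λ j → A c j) ≡ sumR a b (λ j → B c j)
    rowSum-cong A≈B a b c = sumR-cong a b (λ j _ _ → A≈B c j)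

    colSum-cong : ∀ {A B} → A ≈ B → ∀ a b r → sumR a b (λ j → A j r) ≡ sumR a b (λ j → B j r)
    colSum-cong A≈B a b r = sumR-cong a b (λ j _ _ → A≈B j r)

    p₋-cong : ∀ {A B} → A ≈ B → ∀ ℓ → p₋ A ℓ ≡ p₋ B ℓ
    p₋-cong A≈B ℓ = largestMax-cong (λ p → cong₂ _+_ (rowSum-cong A≈B i p ℓ) (rowSum-cong A≈B p n (suc ℓ))) (range i n)

    q₋-cong : ∀ {A B} → A ≈ B → ∀ ℓ → q₋ A ℓ ≡ q₋ B ℓ
    q₋-cong A≈B ℓ = smallestMax-cong (λ p → cong₂ _+_ (rowSum-cong A≈B i p ℓ) (rowSum-cong A≈B p n (suc ℓ))) (range i n)

    p₊-cong : ∀ {A B} → A ≈ B → ∀ ℓ → p₊ A ℓ ≡ p₊ B ℓ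
    p₊-cong A≈B ℓ = smallestMax-cong (λ p → cong₂ _+_ (colSum-cong A≈B 1 p (ℓ ∸ 1)) (colSum-cong A≈B p i ℓ)) (range 1 i)

  φ-cong : ∀ ℓ {A B} → A ≈ B → φ ℓ A ≡ φ ℓ B
  φ-cong ℓ {A} {B} A≈B with ℓ <ᵇ i | i <ᵇ ℓ
  ... | true  | _ rewrite p₋-cong A≈B ℓ =
    cong₂ _∸_ (rowSum-cong A≈B (p₋ B ℓ) n (suc ℓ)) (rowSum-cong A≈B (suc (p₋ B ℓ)) n ℓ)
  ... | false | true rewrite p₊-cong A≈B ℓ =
    cong₂ _∸_ (colSum-cong A≈B 1 (p₊ B ℓ) (ℓ ∸ 1)) (colSum-cong A≈B 1 (p₊ B ℓ ∸ 1) ℓ)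
  ... | false | false = cong₂ _∸_ (cong (m ∸_) (colSum-cong A≈B 1 (i ∸ 1) i)) (rowSum-cong A≈B i n i)

  ε-cong : ∀ ℓ {A B} → A ≈ B → ε ℓ A ≡ ε ℓ B
  ε-cong ℓ {A} {B} A≈B with ℓ <ᵇ i | i <ᵇ ℓ
  ... | true  | _ rewrite q₋-cong A≈B ℓ =
    cong₂ _∸_ (rowSum-cong A≈B i (q₋ B ℓ) ℓ) (rowSum-cong A≈B i (q₋ B ℓ ∸ 1) (suc ℓ))
  ... | false | true  = refl
  ... | false | false = A≈B i i

  fMove-cong : ∀ ℓ {A B} → A ≈ B → fMove ℓ A ≈ fMove ℓ B
  fMove-cong ℓ {A} {B} A≈B with ℓ <ᵇ i | i <ᵇ ℓ
  ... | true  | _ rewrite p₋-cong A≈B ℓ = dec-cong (suc ℓ) (p₋ B ℓ) (inc-cong ℓ (p₋ B ℓ) A≈B)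
  ... | false | true rewrite p₊-cong A≈B ℓ = inc-cong (p₊ B ℓ) ℓ (dec-cong (p₊ B ℓ) (ℓ ∸ 1) A≈B)
  ... | false | false = inc-cong i i A≈B

  eMove-cong : ∀ ℓ {A B} → A ≈ B → eMove ℓ A ≈ eMove ℓ B
  eMove-cong ℓ {A} {B} A≈B with ℓ <ᵇ i | i <ᵇ ℓ
  ... | true  | _ rewrite q₋-cong A≈B ℓ = inc-cong (suc ℓ) (q₋ B ℓ) (dec-cong ℓ (q₋ B ℓ) A≈B)
  ... | false | true  = A≈B
  ... | false | false = dec-cong i i A≈B

  f-resp : ∀ ℓ → Respects≈ (f ℓ)
  f-resp ℓ {A} {B} A≈B with φ ℓ A | φ ℓ B | φ-cong ℓ A≈B
  ... | zero  | zero  | _ = nothing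
  ... | suc _ | suc _ | _ = just (fMove-cong ℓ A≈B)

  e-resp : ∀ ℓ → Respects≈ (e ℓ)
  e-resp ℓ {A} {B} A≈B with ε ℓ A | ε ℓ B | ε-cong ℓ A≈B
  ... | zero  | zero  | _ = nothing
  ... | suc _ | suc _ | _ = just (eMove-cong ℓ A≈B)

  fPow-resp : ∀ ℓ c → Respects≈ (fPow ℓ c)
  fPow-resp ℓ zero    A≈B = just A≈B
  fPow-resp ℓ (suc c) A≈B = >>=-resp (f-resp ℓ A≈B) (fPow-resp ℓ c)

  ePow-resp : ∀ ℓ c → Respects≈ (ePow ℓ c)
  ePow-resp ℓ zero    A≈B = just A≈B
  ePow-resp ℓ (suc c) A≈B = >>=-resp (e-resp ℓ A≈B) (ePow-resp ℓ c)

  fMax-resp : ∀ ℓ → Respects≈ (fMax ℓ)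
  fMax-resp ℓ {A} {B} A≈B rewrite φ-cong ℓ A≈B = fPow-resp ℓ (φ ℓ B) A≈B

  applySeq-resp : ∀ ls g → (∀ ℓ → Respects≈ (g ℓ)) → Respects≈ (applySeq ls g)
  applySeq-resp []       g resp A≈B = just A≈B
  applySeq-resp (ℓ ∷ ls) g resp A≈B = >>=-resp (resp ℓ A≈B) (applySeq-resp ls g resp)

  f-step : ∀ {ℓ A B} → 0 < φ ℓ A → fMove ℓ A ≈ B → f ℓ A ⇓ B
  f-step {ℓ} {A} 0<φ move with φ ℓ A
  ... | suc _ = just move

  e-step : ∀ {ℓ A B} → 0 < ε ℓ A → eMove ℓ A ≈ B → e ℓ A ⇓ B
  e-step {ℓ} {A} 0<ε move with ε ℓ A
  ... | suc _ = just move

  fPow-chain : ∀ ℓ (S : ℕ → Array) j → (∀ r → r < j → f ℓ (S r) ⇓ S (suc r)) → fPow ℓ j (S 0) ⇓ S j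
  fPow-chain ℓ S zero    steps = just ≈-refl
  fPow-chain ℓ S (suc j) steps =
    >>=-⇓ (steps 0 z<s) (fPow-resp ℓ j) (fPow-chain ℓ (S ∘ suc) j (λ r r<j → steps (suc r) (s<s r<j)))

  ePow-chain : ∀ ℓ (S : ℕ → Array) j → (∀ r → r < j → e ℓ (S r) ⇓ S (suc r)) → ePow ℓ j (S 0) ⇓ S j
  ePow-chain ℓ S zero    steps = just ≈-refl
  ePow-chain ℓ S (suc j) steps =
    >>=-⇓ (steps 0 z<s) (ePow-resp ℓ j) (ePow-chain ℓ (S ∘ suc) j (λ r r<j → steps (suc r) (s<s r<j)))

  fPow-+ : ∀ ℓ a b A → fPow ℓ (a + b) A ≡ (fPow ℓ a A >>= fPow ℓ b)
  fPow-+ ℓ zero    b A = refl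
  fPow-+ ℓ (suc a) b A with f ℓ A
  ... | nothing = refl
  ... | just B  = fPow-+ ℓ a b B

  ePow-+ : ∀ ℓ a b A → ePow ℓ (a + b) A ≡ (ePow ℓ a A >>= ePow ℓ b)
  ePow-+ ℓ zero    b A = refl
  ePow-+ ℓ (suc a) b A with e ℓ A
  ... | nothing = refl
  ... | just B  = ePow-+ ℓ a b B

  applySeq-++ : ∀ xs ys g A → applySeq (xs ++ ys) g A ≡ (applySeq xs g A >>= applySeq ys g)
  applySeq-++ []       ys g A = refl
  applySeq-++ (x ∷ xs) ys g A with g x A
  ... | nothing = refl
  ... | just B  = applySeq-++ xs ys g B

  module Below {ℓ : ℕ} (ℓ<i : ℓ < i) where
    φ≡ : ∀ A → φ ℓ A ≡ sumR (p₋ A ℓ) n (λ j → A (suc ℓ) j) ∸ sumR (suc (p₋ A ℓ)) n (λ j → A ℓ j)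
    φ≡ A rewrite <ᵇ-true ℓ<i = refl
    ε≡ : ∀ A → ε ℓ A ≡ sumR i (q₋ A ℓ) (λ j → A ℓ j) ∸ sumR i (q₋ A ℓ ∸ 1) (λ j → A (suc ℓ) j)
    ε≡ A rewrite <ᵇ-true ℓ<i = refl
    fMove≡ : ∀ A → fMove ℓ A ≡ dec (suc ℓ) (p₋ A ℓ) (inc ℓ (p₋ A ℓ) A)
    fMove≡ A rewrite <ᵇ-true ℓ<i = refl
    eMove≡ : ∀ A → eMove ℓ A ≡ inc (suc ℓ) (q₋ A ℓ) (dec ℓ (q₋ A ℓ) A)
    eMove≡ A rewrite <ᵇ-true ℓ<i = refl

  module Above {ℓ : ℕ} (i<ℓ : i < ℓ) where
    φ≡ : ∀ A → φ ℓ A ≡ sumR 1 (p₊ A ℓ) (λ j → A j (ℓ ∸ 1)) ∸ sumR 1 (p₊ A ℓ ∸ 1) (λ j → A j ℓ)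
    φ≡ A rewrite <ᵇ-false (<⇒≯ i<ℓ) | <ᵇ-true i<ℓ = refl
    fMove≡ : ∀ A → fMove ℓ A ≡ inc (p₊ A ℓ) ℓ (dec (p₊ A ℓ) (ℓ ∸ 1) A)
    fMove≡ A rewrite <ᵇ-false (<⇒≯ i<ℓ) | <ᵇ-true i<ℓ = refl

  module At where
    φ≡ : ∀ A → φ i A ≡ (m ∸ sumR 1 (i ∸ 1) (λ j → A j i)) ∸ sumR i n (λ j → A i j)
    φ≡ A rewrite <ᵇ-false (<-irrefl {i} refl) = refl
    ε≡ : ∀ A → ε i A ≡ A i i
    ε≡ A rewrite <ᵇ-false (<-irrefl {i} refl) = refl
    fMove≡ : ∀ A → fMove i A ≡ inc i i A
    fMove≡ A rewrite <ᵇ-false (<-irrefl {i} refl) = refl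
    eMove≡ : ∀ A → eMove i A ≡ dec i i A
    eMove≡ A rewrite <ᵇ-false (<-irrefl {i} refl) = refl

-- Moving one unit between two adjacent columns

moveLeft moveRight : ℕ → ℕ → Array → Array
moveLeft  ℓ p A = dec (suc ℓ) p (inc ℓ p A)
moveRight ℓ p A = inc (suc ℓ) p (dec ℓ p A)

n≢1+n : ∀ {n} → n ≢ suc n
n≢1+n = 1+n≢n ∘ sym

module _ (ℓ p : ℕ) (A : Array) where

  moveLeft-from : moveLeft ℓ p A (suc ℓ) p ≡ A (suc ℓ) p ∸ 1
  moveLeft-from = trans (dec-here (suc ℓ) p (inc ℓ p A)) (cong (_∸ 1) (inc-col p A p n≢1+n))

  moveLeft-to : moveLeft ℓ p A ℓ p ≡ suc (A ℓ p)
  moveLeft-to = trans (dec-col p (inc ℓ p A) p 1+n≢n) (inc-here ℓ p A)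

  moveLeft-row : ∀ c {j} → j ≢ p → moveLeft ℓ p A c j ≡ A c j
  moveLeft-row c j≢p = trans (dec-row (suc ℓ) (inc ℓ p A) c (j≢p ∘ sym)) (inc-row ℓ A c (j≢p ∘ sym))

  moveLeft-col : ∀ {c} j → c ≢ ℓ → c ≢ suc ℓ → moveLeft ℓ p A c j ≡ A c j
  moveLeft-col j c≢ℓ c≢1+ℓ = trans (dec-col p (inc ℓ p A) j (c≢1+ℓ ∘ sym)) (inc-col p A j (c≢ℓ ∘ sym))

  moveRight-from : moveRight ℓ p A ℓ p ≡ A ℓ p ∸ 1
  moveRight-from = trans (inc-col p (dec ℓ p A) p 1+n≢n) (dec-here ℓ p A)

  moveRight-to : moveRight ℓ p A (suc ℓ) p ≡ suc (A (suc ℓ) p)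
  moveRight-to = trans (inc-here (suc ℓ) p (dec ℓ p A)) (cong suc (dec-col p A p n≢1+n))

  moveRight-row : ∀ c {j} → j ≢ p → moveRight ℓ p A c j ≡ A c j
  moveRight-row c j≢p = trans (inc-row (suc ℓ) (dec ℓ p A) c (j≢p ∘ sym)) (dec-row ℓ A c (j≢p ∘ sym))

  moveRight-col : ∀ {c} j → c ≢ ℓ → c ≢ suc ℓ → moveRight ℓ p A c j ≡ A c j
  moveRight-col j c≢ℓ c≢1+ℓ = trans (inc-col p (dec ℓ p A) j (c≢1+ℓ ∘ sym)) (dec-col p A j (c≢ℓ ∘ sym))

moveRight-moveLeft : ∀ ℓ p A → 0 < A (suc ℓ) p → moveRight ℓ p (moveLeft ℓ p A) ≈ A
moveRight-moveLeft ℓ p A pos c j with j ≟ p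
... | no j≢p = trans (moveRight-row ℓ p (moveLeft ℓ p A) c j≢p) (moveLeft-row ℓ p A c j≢p)
... | yes refl with c ≟ ℓ | c ≟ suc ℓ
...   | yes refl | _        = trans (moveRight-from c j (moveLeft c j A)) (cong (_∸ 1) (moveLeft-to c j A))
...   | no _     | yes refl = trans (moveRight-to ℓ j (moveLeft ℓ j A)) (trans (cong suc (moveLeft-from ℓ j A)) (suc[m∸1]≡m pos))
...   | no c≢ℓ   | no c≢1+ℓ = trans (moveRight-col ℓ j (moveLeft ℓ j A) j c≢ℓ c≢1+ℓ) (moveLeft-col ℓ j A j c≢ℓ c≢1+ℓ)

-- W lo A ℓ is U of case (iii) for lo = i, and T of case (ii) for the transposed array with n := i.
module ColumnPair (n : ℕ) where

  W : ℕ → Array → ℕ → ℕ → ℕ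
  W lo A ℓ q = sumR lo q (λ j → A ℓ j) + sumR q n (λ j → A (suc ℓ) j)

  W-suc : ∀ {lo q} A ℓ → lo ≤ q → q < n → W lo A ℓ (suc q) + A (suc ℓ) q ≡ W lo A ℓ q + A ℓ (suc q)
  W-suc {lo} {q} A ℓ lo≤q q<n = begin
    sumR lo (suc q) u + sumR (suc q) n v + v q        ≡⟨ cong (λ x → x + sumR (suc q) n v + v q) (sumR-snoc u (m≤n⇒m≤1+n lo≤q)) ⟩
    sumR lo q u + u (suc q) + sumR (suc q) n v + v q
      ≡⟨ solve 4 (λ x y z w → x :+ y :+ z :+ w := x :+ (w :+ z) :+ y) refl (sumR lo q u) (u (suc q)) (sumR (suc q) n v) (v q) ⟩
    sumR lo q u + (v q + sumR (suc q) n v) + u (suc q) ≡⟨ cong (λ x → sumR lo q u + x + u (suc q)) (sym (sumR-cons v (<⇒≤ q<n))) ⟩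
    sumR lo q u + sumR q n v + u (suc q)              ∎
    where
    open ≡-Reasoning
    u : ℕ → ℕ
    u = λ j → A ℓ j
    v : ℕ → ℕ
    v = λ j → A (suc ℓ) j

  W-last : ∀ {lo} A ℓ → lo ≤ n → W lo A ℓ n ≡ sumR lo n (λ j → A ℓ j) + A (suc ℓ) n
  W-last {lo} A ℓ lo≤n = cong (sumR lo n (λ j → A ℓ j) +_) (sumR-single n (λ j → A (suc ℓ) j))

  W-first : ∀ {lo} A ℓ → W lo A ℓ lo ≡ A ℓ lo + sumR lo n (λ j → A (suc ℓ) j)
  W-first {lo} A ℓ = cong (_+ sumR lo n (λ j → A (suc ℓ) j)) (sumR-single lo (λ j → A ℓ j))

  -- By φ-formula and ε-formula below, the strict inequalities say φ > 0 and ε > 0 respectively.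
  lastMax-source-pos : ∀ {lo p} A ℓ → IsLastMax (W lo A ℓ) lo n p →
                       sumR lo n (λ j → A ℓ j) < W lo A ℓ p → 0 < A (suc ℓ) p
  lastMax-source-pos {lo} {p} A ℓ (lastMax lo≤p p≤n _ beyond) Σu<Wp with A (suc ℓ) p in Ap≡0
  ... | suc _ = z<s
  ... | zero with m≤n⇒m<n∨m≡n p≤n
  ...   | inj₂ refl =
    ⊥-elim (<-irrefl (sym (trans (W-last A ℓ lo≤p) (trans (cong (sumR lo p (λ j → A ℓ j) +_) Ap≡0) (+-identityʳ _)))) Σu<Wp)
  ...   | inj₁ p<n  = ⊥-elim (<⇒≱ (beyond (suc p) ≤-refl p<n) (begin
    W lo A ℓ p                       ≤⟨ m≤m+n _ _ ⟩
    W lo A ℓ p + A ℓ (suc p)         ≡⟨ sym (W-suc A ℓ lo≤p p<n) ⟩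
    W lo A ℓ (suc p) + A (suc ℓ) p   ≡⟨ cong (W lo A ℓ (suc p) +_) Ap≡0 ⟩
    W lo A ℓ (suc p) + 0             ≡⟨ +-identityʳ _ ⟩
    W lo A ℓ (suc p)                 ∎))
    where open ≤-Reasoning

  firstMax-source-pos : ∀ {lo p} A ℓ → IsFirstMax (W lo A ℓ) lo n p →
                        sumR lo n (λ j → A (suc ℓ) j) < W lo A ℓ p → 0 < A ℓ p
  firstMax-source-pos {lo} {p} A ℓ (firstMax lo≤p p≤n _ before) Σv<Wp with A ℓ p in Ap≡0
  ... | suc _ = z<s
  ... | zero with m≤n⇒m<n∨m≡n lo≤p
  ...   | inj₂ refl = ⊥-elim (<-irrefl (sym (trans (W-first A ℓ) (cong (_+ sumR lo n (λ j → A (suc ℓ) j)) Ap≡0))) Σv<Wp)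
  firstMax-source-pos {lo} {suc p} A ℓ (firstMax lo≤p p≤n _ before) Σv<Wp | zero | inj₁ (s≤s lo≤p′) =
    ⊥-elim (<⇒≱ (before p lo≤p′ ≤-refl) (begin
      W lo A ℓ (suc p)                 ≤⟨ m≤m+n _ _ ⟩
      W lo A ℓ (suc p) + A (suc ℓ) p   ≡⟨ W-suc A ℓ lo≤p′ p≤n ⟩
      W lo A ℓ p + A ℓ (suc p)         ≡⟨ cong (W lo A ℓ p +_) Ap≡0 ⟩
      W lo A ℓ p + 0                   ≡⟨ +-identityʳ _ ⟩
      W lo A ℓ p                       ∎))
    where open ≤-Reasoning

  -- The left-hand sides are the defining formulas of φ (case iii) and ε (cases ii and iii) at a maximiser.
  φ-formula : ∀ {lo p} A ℓ → lo ≤ p → p ≤ n → sumR lo n (λ j → A ℓ j) ≤ W lo A ℓ p →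
              (sumR p n (λ j → A (suc ℓ) j) ∸ sumR (suc p) n (λ j → A ℓ j)) + sumR lo n (λ j → A ℓ j) ≡ W lo A ℓ p
  φ-formula {lo} {p} A ℓ lo≤p p≤n Σu≤Wp = begin
    (V ∸ U₂) + sumR lo n u   ≡⟨ cong ((V ∸ U₂) +_) split ⟩
    (V ∸ U₂) + (U₁ + U₂)     ≡⟨ x∙yz≈y∙xz (V ∸ U₂) U₁ U₂ ⟩
    U₁ + ((V ∸ U₂) + U₂)     ≡⟨ cong (U₁ +_) (m∸n+n≡m U₂≤V) ⟩
    U₁ + V                   ∎
    where
    open ≡-Reasoning
    u : ℕ → ℕ
    u = λ j → A ℓ j
    U₁ : ℕ
    U₁ = sumR lo p u
    U₂ : ℕ
    U₂ = sumR (suc p) n u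
    V : ℕ
    V = sumR p n (λ j → A (suc ℓ) j)
    split : sumR lo n u ≡ U₁ + U₂
    split = sumR-split u (m≤n⇒m≤1+n lo≤p) p≤n
    U₂≤V : U₂ ≤ V
    U₂≤V = +-cancelˡ-≤ U₁ U₂ V (subst (_≤ U₁ + V) split Σu≤Wp)

  ε-formula : ∀ {lo q} A ℓ → 1 ≤ lo → lo ≤ q → q ≤ n → sumR lo n (λ j → A (suc ℓ) j) ≤ W lo A ℓ q →
              (sumR lo q (λ j → A ℓ j) ∸ sumR lo (q ∸ 1) (λ j → A (suc ℓ) j)) + sumR lo n (λ j → A (suc ℓ) j) ≡ W lo A ℓ q
  ε-formula {lo} {suc q} A ℓ _ lo≤q q≤n Σv≤Wq = begin
    (U ∸ V₁) + sumR lo n v   ≡⟨ cong ((U ∸ V₁) +_) split ⟩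
    (U ∸ V₁) + (V₁ + V₂)     ≡⟨ sym (+-assoc (U ∸ V₁) V₁ V₂) ⟩
    (U ∸ V₁) + V₁ + V₂       ≡⟨ cong (_+ V₂) (m∸n+n≡m V₁≤U) ⟩
    U + V₂                   ∎
    where
    open ≡-Reasoning
    v : ℕ → ℕ
    v = λ j → A (suc ℓ) j
    U : ℕ
    U = sumR lo (suc q) (λ j → A ℓ j)
    V₁ : ℕ
    V₁ = sumR lo q v
    V₂ : ℕ
    V₂ = sumR (suc q) n v
    split : sumR lo n v ≡ V₁ + V₂
    split = sumR-split v lo≤q (≤-trans (n≤1+n q) q≤n)
    V₁≤U : V₁ ≤ U
    V₁≤U = +-cancelʳ-≤ V₂ V₁ U (subst (_≤ U + V₂) split Σv≤Wq)
  ε-formula {q = zero} A ℓ 1≤lo lo≤0 _ _ = ⊥-elim (<⇒≱ 1≤lo lo≤0)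

  W-split : ∀ {lo p q} A ℓ → 1 ≤ p → lo ≤ p → p ≤ q → W lo A ℓ q ≡ sumR lo (p ∸ 1) (λ j → A ℓ j) + W p A ℓ q
  W-split {lo} {suc p} {q} A ℓ _ lo≤1+p 1+p≤q =
    trans (cong (_+ sumR q n (λ j → A (suc ℓ) j)) (sumR-split (λ j → A ℓ j) lo≤1+p (≤-trans (n≤1+n p) 1+p≤q)))
          (+-assoc (sumR lo p (λ j → A ℓ j)) _ _)

  module MoveLeft {lo p : ℕ} (A : Array) (ℓ : ℕ) (lo≤p : lo ≤ p) (p≤n : p ≤ n) (pos : 0 < A (suc ℓ) p) where
    private
      B : Array
      B = moveLeft ℓ p A
      u : ℕ → ℕ
      u = λ j → A ℓ j
      v : ℕ → ℕ
      v = λ j → A (suc ℓ) j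
      u′ : ℕ → ℕ
      u′ = λ j → B ℓ j
      v′ : ℕ → ℕ
      v′ = λ j → B (suc ℓ) j
      v-at : v p ≡ suc (v′ p)
      v-at = sym (trans (cong suc (moveLeft-from ℓ p A)) (suc[m∸1]≡m pos))

    rowℓ-grows : ∀ {a b} → a ≤ p → p ≤ b → sumR a b u′ ≡ suc (sumR a b u)
    rowℓ-grows a≤p p≤b = sumR-suc-at u u′ a≤p p≤b (moveLeft-to ℓ p A) (λ j → moveLeft-row ℓ p A ℓ)

    rowℓ+1-shrinks : ∀ {a b} → a ≤ p → p ≤ b → suc (sumR a b v′) ≡ sumR a b v
    rowℓ+1-shrinks a≤p p≤b = sym (sumR-suc-at v′ v a≤p p≤b v-at (λ j j≢p → sym (moveLeft-row ℓ p A (suc ℓ) j≢p)))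

    W-before : ∀ {q} → q < p → suc (W lo B ℓ q) ≡ W lo A ℓ q
    W-before {q} q<p = begin
      suc (sumR lo q u′ + sumR q n v′)
        ≡⟨ cong (λ x → suc (x + sumR q n v′)) (sumR-outside lo q u u′ (λ j → moveLeft-row ℓ p A ℓ) (inj₁ q<p)) ⟩
      suc (sumR lo q u + sumR q n v′)   ≡⟨ sym (+-suc _ _) ⟩
      sumR lo q u + suc (sumR q n v′)   ≡⟨ cong (sumR lo q u +_) (rowℓ+1-shrinks (<⇒≤ q<p) p≤n) ⟩
      sumR lo q u + sumR q n v          ∎
      where open ≡-Reasoning

    W-at : W lo B ℓ p ≡ W lo A ℓ p
    W-at = begin
      sumR lo p u′ + sumR p n v′        ≡⟨ cong (_+ sumR p n v′) (rowℓ-grows lo≤p ≤-refl) ⟩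
      suc (sumR lo p u) + sumR p n v′   ≡⟨ sym (+-suc _ _) ⟩
      sumR lo p u + suc (sumR p n v′)   ≡⟨ cong (sumR lo p u +_) (rowℓ+1-shrinks ≤-refl p≤n) ⟩
      sumR lo p u + sumR p n v          ∎
      where open ≡-Reasoning

    W-after : ∀ {q} → p < q → W lo B ℓ q ≡ suc (W lo A ℓ q)
    W-after {q} p<q = cong₂ _+_ (rowℓ-grows lo≤p (<⇒≤ p<q)) (sumR-outside q n v v′ (λ j → moveLeft-row ℓ p A (suc ℓ)) (inj₂ p<q))

    lastMax⇒firstMax : IsLastMax (W lo A ℓ) lo n p → IsFirstMax (W lo B ℓ) lo n p
    lastMax⇒firstMax (lastMax _ _ maximal beyond) = firstMax lo≤p p≤n maximal′ before′
      where
      maximal′ : ∀ q → lo ≤ q → q ≤ n → W lo B ℓ q ≤ W lo B ℓ p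
      maximal′ q lo≤q q≤n with <-cmp q p
      ... | tri< q<p _ _ = subst₂ _≤_ refl (sym W-at) (≤-trans (n≤1+n _) (subst (_≤ W lo A ℓ p) (sym (W-before q<p)) (maximal q lo≤q q≤n)))
      ... | tri≈ _ refl _ = ≤-refl
      ... | tri> _ _ p<q = subst₂ _≤_ (sym (W-after p<q)) (sym W-at) (beyond q p<q q≤n)
      before′ : ∀ q → lo ≤ q → q < p → W lo B ℓ q < W lo B ℓ p
      before′ q lo≤q q<p = subst₂ _≤_ (sym (W-before q<p)) (sym W-at) (maximal q lo≤q (≤-trans (<⇒≤ q<p) p≤n))

  module MoveRight {lo p : ℕ} (A : Array) (ℓ : ℕ) (lo≤p : lo ≤ p) (p≤n : p ≤ n) (pos : 0 < A ℓ p) where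
    private
      B : Array
      B = moveRight ℓ p A
      u : ℕ → ℕ
      u = λ j → A ℓ j
      v : ℕ → ℕ
      v = λ j → A (suc ℓ) j
      u′ : ℕ → ℕ
      u′ = λ j → B ℓ j
      v′ : ℕ → ℕ
      v′ = λ j → B (suc ℓ) j
      u-at : u p ≡ suc (u′ p)
      u-at = sym (trans (cong suc (moveRight-from ℓ p A)) (suc[m∸1]≡m pos))

    rowℓ-shrinks : ∀ {a b} → a ≤ p → p ≤ b → suc (sumR a b u′) ≡ sumR a b u
    rowℓ-shrinks a≤p p≤b = sym (sumR-suc-at u′ u a≤p p≤b u-at (λ j j≢p → sym (moveRight-row ℓ p A ℓ j≢p)))

    rowℓ+1-grows : ∀ {a b} → a ≤ p → p ≤ b → sumR a b v′ ≡ suc (sumR a b v)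
    rowℓ+1-grows a≤p p≤b = sumR-suc-at v v′ a≤p p≤b (moveRight-to ℓ p A) (λ j → moveRight-row ℓ p A (suc ℓ))

    W-before : ∀ {q} → q < p → W lo B ℓ q ≡ suc (W lo A ℓ q)
    W-before {q} q<p =
      trans (cong₂ _+_ (sumR-outside lo q u u′ (λ j → moveRight-row ℓ p A ℓ) (inj₁ q<p)) (rowℓ+1-grows (<⇒≤ q<p) p≤n)) (+-suc _ _)

    W-at : W lo B ℓ p ≡ W lo A ℓ p
    W-at = begin
      sumR lo p u′ + sumR p n v′        ≡⟨ cong (sumR lo p u′ +_) (rowℓ+1-grows ≤-refl p≤n) ⟩
      sumR lo p u′ + suc (sumR p n v)   ≡⟨ +-suc _ _ ⟩
      suc (sumR lo p u′) + sumR p n v   ≡⟨ cong (_+ sumR p n v) (rowℓ-shrinks lo≤p ≤-refl) ⟩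
      sumR lo p u + sumR p n v          ∎
      where open ≡-Reasoning

    W-after : ∀ {q} → p < q → suc (W lo B ℓ q) ≡ W lo A ℓ q
    W-after {q} p<q = cong₂ _+_ (rowℓ-shrinks lo≤p (<⇒≤ p<q)) (sumR-outside q n v v′ (λ j → moveRight-row ℓ p A (suc ℓ)) (inj₂ p<q))

    firstMax⇒lastMax : IsFirstMax (W lo A ℓ) lo n p → IsLastMax (W lo B ℓ) lo n p
    firstMax⇒lastMax (firstMax _ _ maximal before) = lastMax lo≤p p≤n maximal′ beyond′
      where
      maximal′ : ∀ q → lo ≤ q → q ≤ n → W lo B ℓ q ≤ W lo B ℓ p
      maximal′ q lo≤q q≤n with <-cmp q p
      ... | tri< q<p _ _ = subst₂ _≤_ (sym (W-before q<p)) (sym W-at) (before q lo≤q q<p)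
      ... | tri≈ _ refl _ = ≤-refl
      ... | tri> _ _ p<q =
        subst (W lo B ℓ q ≤_) (sym W-at) (≤-trans (n≤1+n _) (subst (_≤ W lo A ℓ p) (sym (W-after p<q)) (maximal q lo≤q q≤n)))
      beyond′ : ∀ q → p < q → q ≤ n → W lo B ℓ q < W lo B ℓ p
      beyond′ q p<q q≤n = subst₂ _≤_ (sym (W-after p<q)) (sym W-at) (maximal q (≤-trans lo≤p (<⇒≤ p<q)) q≤n)

setRow : Array → ℕ → (ℕ → ℕ) → Array
setRow A r x p q = if q ≡ᵇ r then x p else A p q

setRow-at : ∀ A r x p → setRow A r x p r ≡ x p
setRow-at A r x p rewrite ≡ᵇ-refl r = refl

setRow-off : ∀ A {r q} x p → q ≢ r → setRow A r x p q ≡ A p q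
setRow-off A x p q≢r rewrite ≡ᵇ-false q≢r = refl

setRow-cong : ∀ {T T′} r x → T ≈ T′ → setRow T r x ≈ setRow T′ r x
setRow-cong r x T≈T′ p q with q ≡ᵇ r
... | true  = refl
... | false = T≈T′ p q

setRow-congʳ : ∀ T r {x y} → (∀ p → x p ≡ y p) → setRow T r x ≈ setRow T r y
setRow-congʳ T r x≗y p q with q ≡ᵇ r
... | true  = x≗y p
... | false = refl

setPair : (ℕ → ℕ) → ℕ → ℕ → ℕ → (ℕ → ℕ)
setPair x ℓ a b = setAt (setAt x ℓ a) (suc ℓ) b

setPair-fst : ∀ x ℓ a b → setPair x ℓ a b ℓ ≡ a
setPair-fst x ℓ a b = trans (setAt-off (setAt x ℓ a) b n≢1+n) (setAt-at x ℓ a)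

setPair-snd : ∀ x ℓ a b → setPair x ℓ a b (suc ℓ) ≡ b
setPair-snd x ℓ a b = setAt-at (setAt x ℓ a) (suc ℓ) b

setPair-off : ∀ x {ℓ j} a b → j ≢ ℓ → j ≢ suc ℓ → setPair x ℓ a b j ≡ x j
setPair-off x {ℓ} a b j≢ℓ j≢1+ℓ = trans (setAt-off (setAt x ℓ a) b j≢1+ℓ) (setAt-off x a j≢ℓ)

setPair-same : ∀ x ℓ j → setPair x ℓ (x ℓ) (x (suc ℓ)) j ≡ x j
setPair-same x ℓ j with j ≟ ℓ | j ≟ suc ℓ
... | yes refl | _        = setPair-fst x j _ _
... | no _     | yes refl = setPair-snd x ℓ _ _
... | no j≢ℓ   | no j≢1+ℓ = setPair-off x _ _ j≢ℓ j≢1+ℓ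

moveLeft-setRow-off : ∀ ℓ {p r} T x → p ≢ r → moveLeft ℓ p (setRow T r x) ≈ setRow (moveLeft ℓ p T) r x
moveLeft-setRow-off ℓ {p} {r} T x p≢r c q with q ≟ r
... | yes refl = trans (moveLeft-row ℓ p (setRow T q x) c (p≢r ∘ sym)) (trans (setRow-at T q x c) (sym (setRow-at (moveLeft ℓ p T) q x c)))
... | no q≢r   = trans (dec-local (suc ℓ) p {inc ℓ p (setRow T r x)} {inc ℓ p T} (inc-local ℓ p {setRow T r x} {T} (setRow-off T x c q≢r)))
                       (sym (setRow-off (moveLeft ℓ p T) x c q≢r))

moveRight-setRow-off : ∀ ℓ {p r} T x → p ≢ r → moveRight ℓ p (setRow T r x) ≈ setRow (moveRight ℓ p T) r x
moveRight-setRow-off ℓ {p} {r} T x p≢r c q with q ≟ r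
... | yes refl = trans (moveRight-row ℓ p (setRow T q x) c (p≢r ∘ sym)) (trans (setRow-at T q x c) (sym (setRow-at (moveRight ℓ p T) q x c)))
... | no q≢r   = trans (inc-local (suc ℓ) p {dec ℓ p (setRow T r x)} {dec ℓ p T} (dec-local ℓ p {setRow T r x} {T} (setRow-off T x c q≢r)))
                       (sym (setRow-off (moveRight ℓ p T) x c q≢r))

moveLeft-setRow : ∀ ℓ r T {x y} → y ℓ ≡ suc (x ℓ) → y (suc ℓ) ≡ x (suc ℓ) ∸ 1 →
                  (∀ j → j ≢ ℓ → j ≢ suc ℓ → y j ≡ x j) → moveLeft ℓ r (setRow T r x) ≈ setRow T r y
moveLeft-setRow ℓ r T {x} {y} yℓ y1+ℓ rest c q with q ≟ r
... | no q≢r = trans (moveLeft-row ℓ r (setRow T r x) c q≢r) (trans (setRow-off T x c q≢r) (sym (setRow-off T y c q≢r)))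
... | yes refl with c ≟ ℓ | c ≟ suc ℓ
...   | yes refl | _ =
  trans (moveLeft-to c q (setRow T q x)) (trans (cong suc (setRow-at T q x c)) (sym (trans (setRow-at T q y c) yℓ)))
...   | no _ | yes refl =
  trans (moveLeft-from ℓ q (setRow T q x)) (trans (cong (_∸ 1) (setRow-at T q x (suc ℓ))) (sym (trans (setRow-at T q y (suc ℓ)) y1+ℓ)))
...   | no c≢ℓ | no c≢1+ℓ =
  trans (moveLeft-col ℓ q (setRow T q x) q c≢ℓ c≢1+ℓ) (trans (setRow-at T q x c) (sym (trans (setRow-at T q y c) (rest c c≢ℓ c≢1+ℓ))))

moveRight-setRow : ∀ ℓ r T {x y} → y ℓ ≡ x ℓ ∸ 1 → y (suc ℓ) ≡ suc (x (suc ℓ)) →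
                   (∀ j → j ≢ ℓ → j ≢ suc ℓ → y j ≡ x j) → moveRight ℓ r (setRow T r x) ≈ setRow T r y
moveRight-setRow ℓ r T {x} {y} yℓ y1+ℓ rest c q with q ≟ r
... | no q≢r = trans (moveRight-row ℓ r (setRow T r x) c q≢r) (trans (setRow-off T x c q≢r) (sym (setRow-off T y c q≢r)))
... | yes refl with c ≟ ℓ | c ≟ suc ℓ
...   | yes refl | _ =
  trans (moveRight-from c q (setRow T q x)) (trans (cong (_∸ 1) (setRow-at T q x c)) (sym (trans (setRow-at T q y c) yℓ)))
...   | no _ | yes refl =
  trans (moveRight-to ℓ q (setRow T q x)) (trans (cong suc (setRow-at T q x (suc ℓ))) (sym (trans (setRow-at T q y (suc ℓ)) y1+ℓ)))
...   | no c≢ℓ | no c≢1+ℓ =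
  trans (moveRight-col ℓ q (setRow T q x) q c≢ℓ c≢1+ℓ) (trans (setRow-at T q x c) (sym (trans (setRow-at T q y c) (rest c c≢ℓ c≢1+ℓ))))

moveLeft-setPair : ∀ ℓ r T x a b → moveLeft ℓ r (setRow T r (setPair x ℓ a b)) ≈ setRow T r (setPair x ℓ (suc a) (b ∸ 1))
moveLeft-setPair ℓ r T x a b = moveLeft-setRow ℓ r T
  (trans (setPair-fst x ℓ _ _) (cong suc (sym (setPair-fst x ℓ a b))))
  (trans (setPair-snd x ℓ _ _) (cong (_∸ 1) (sym (setPair-snd x ℓ a b))))
  (λ j j≢ℓ j≢1+ℓ → trans (setPair-off x _ _ j≢ℓ j≢1+ℓ) (sym (setPair-off x a b j≢ℓ j≢1+ℓ)))

moveRight-setPair : ∀ ℓ r T x a b → moveRight ℓ r (setRow T r (setPair x ℓ a b)) ≈ setRow T r (setPair x ℓ (a ∸ 1) (suc b))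
moveRight-setPair ℓ r T x a b = moveRight-setRow ℓ r T
  (trans (setPair-fst x ℓ _ _) (cong (_∸ 1) (sym (setPair-fst x ℓ a b))))
  (trans (setPair-snd x ℓ _ _) (cong suc (sym (setPair-snd x ℓ a b))))
  (λ j j≢ℓ j≢1+ℓ → trans (setPair-off x _ _ j≢ℓ j≢1+ℓ) (sym (setPair-off x a b j≢ℓ j≢1+ℓ)))

inc-setRow : ∀ c r T {x y} → y c ≡ suc (x c) → (∀ j → j ≢ c → y j ≡ x j) → inc c r (setRow T r x) ≈ setRow T r y
inc-setRow c r T {x} {y} yc rest p q with q ≟ r
... | no q≢r = trans (inc-row c (setRow T r x) p (q≢r ∘ sym)) (trans (setRow-off T x p q≢r) (sym (setRow-off T y p q≢r)))
... | yes refl with p ≟ c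
...   | yes refl = trans (inc-here p q (setRow T q x)) (trans (cong suc (setRow-at T q x p)) (sym (trans (setRow-at T q y p) yc)))
...   | no p≢c = trans (inc-col q (setRow T q x) q (p≢c ∘ sym)) (trans (setRow-at T q x p) (sym (trans (setRow-at T q y p) (rest p p≢c))))

dec-setRow : ∀ c r T {x y} → y c ≡ x c ∸ 1 → (∀ j → j ≢ c → y j ≡ x j) → dec c r (setRow T r x) ≈ setRow T r y
dec-setRow c r T {x} {y} yc rest p q with q ≟ r
... | no q≢r = trans (dec-row c (setRow T r x) p (q≢r ∘ sym)) (trans (setRow-off T x p q≢r) (sym (setRow-off T y p q≢r)))
... | yes refl with p ≟ c
...   | yes refl = trans (dec-here p q (setRow T q x)) (trans (cong (_∸ 1) (setRow-at T q x p)) (sym (trans (setRow-at T q y p) yc)))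
...   | no p≢c = trans (dec-col q (setRow T q x) q (p≢c ∘ sym)) (trans (setRow-at T q x p) (sym (trans (setRow-at T q y p) (rest p p≢c))))

-- Head row and tail

module HeadTail (n i m : ℕ) (1≤i : 1 ≤ i) (i≤n : i ≤ n) where
  open Crystal n i m
  open Operators n i m
  open ColumnPair n

  withHead : Array → (ℕ → ℕ) → Array
  withHead T x = setRow T i x

  tailSum : Array → ℕ → ℕ
  tailSum T c = sumR (suc i) n (λ j → T c j)

  tailLast tailFirst tailMax : Array → ℕ → ℕ
  tailLast  T ℓ = largestMax (W (suc i) T ℓ) (range (suc i) n)
  tailFirst T ℓ = smallestMax (W (suc i) T ℓ) (range (suc i) n)
  tailMax   T ℓ = maxR (W (suc i) T ℓ) (suc i) n

  tailLeft tailRight : ℕ → Array → Array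
  tailLeft  ℓ T = moveLeft ℓ (tailLast T ℓ) T
  tailRight ℓ T = moveRight ℓ (tailFirst T ℓ) T

  sumR-withHead-tail : ∀ T x c {a} b → suc i ≤ a → sumR a b (λ j → withHead T x c j) ≡ sumR a b (λ j → T c j)
  sumR-withHead-tail T x c {a} b 1+i≤a = sumR-cong a b (λ j a≤j _ → setRow-off T x c (>⇒≢ (≤-trans 1+i≤a a≤j)))

  rowSum-withHead : ∀ T x c → sumR i n (λ j → withHead T x c j) ≡ x c + tailSum T c
  rowSum-withHead T x c =
    trans (sumR-cons (λ j → withHead T x c j) i≤n) (cong₂ _+_ (setRow-at T i x c) (sumR-withHead-tail T x c n ≤-refl))

  W-withHead-tail : ∀ T x ℓ {q} → suc i ≤ q → W i (withHead T x) ℓ q ≡ x ℓ + W (suc i) T ℓ q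
  W-withHead-tail T x ℓ {q} 1+i≤q = begin
    sumR i q (λ j → withHead T x ℓ j) + sumR q n (λ j → withHead T x (suc ℓ) j)
      ≡⟨ cong₂ _+_ (sumR-cons (λ j → withHead T x ℓ j) (≤-trans (n≤1+n i) 1+i≤q)) (sumR-withHead-tail T x (suc ℓ) n 1+i≤q) ⟩
    (withHead T x ℓ i + sumR (suc i) q (λ j → withHead T x ℓ j)) + sumR q n (λ j → T (suc ℓ) j)
      ≡⟨ cong (λ y → (y + sumR (suc i) q (λ j → withHead T x ℓ j)) + sumR q n (λ j → T (suc ℓ) j)) (setRow-at T i x ℓ) ⟩
    (x ℓ + sumR (suc i) q (λ j → withHead T x ℓ j)) + sumR q n (λ j → T (suc ℓ) j)
      ≡⟨ cong (λ y → (x ℓ + y) + sumR q n (λ j → T (suc ℓ) j)) (sumR-withHead-tail T x ℓ q ≤-refl) ⟩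
    (x ℓ + sumR (suc i) q (λ j → T ℓ j)) + sumR q n (λ j → T (suc ℓ) j)
      ≡⟨ +-assoc (x ℓ) _ _ ⟩
    x ℓ + W (suc i) T ℓ q ∎
    where open ≡-Reasoning

  W-withHead-head : ∀ T x ℓ → W i (withHead T x) ℓ i ≡ x ℓ + (x (suc ℓ) + tailSum T (suc ℓ))
  W-withHead-head T x ℓ = cong₂ _+_ (trans (sumR-single i _) (setRow-at T i x ℓ)) (rowSum-withHead T x (suc ℓ))

  p₋-lastMax : ∀ A ℓ → IsLastMax (W i A ℓ) i n (p₋ A ℓ)
  p₋-lastMax A ℓ = largestMax-correct (W i A ℓ) i≤n

  q₋-firstMax : ∀ A ℓ → IsFirstMax (W i A ℓ) i n (q₋ A ℓ)
  q₋-firstMax A ℓ = smallestMax-correct (W i A ℓ) i≤n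

  φ-value : ∀ {ℓ} → ℓ < i → ∀ A → φ ℓ A + sumR i n (λ j → A ℓ j) ≡ W i A ℓ (p₋ A ℓ)
  φ-value {ℓ} ℓ<i A rewrite Below.φ≡ ℓ<i A =
    φ-formula A ℓ lower upper (≤-trans (m≤m+n _ _) (maximal n i≤n ≤-refl))
    where open IsLastMax (p₋-lastMax A ℓ)

  ε-value : ∀ {ℓ} → ℓ < i → ∀ A → ε ℓ A + sumR i n (λ j → A (suc ℓ) j) ≡ W i A ℓ (q₋ A ℓ)
  ε-value {ℓ} ℓ<i A rewrite Below.ε≡ ℓ<i A =
    ε-formula A ℓ 1≤i lower upper (≤-trans (m≤n+m _ _) (maximal i ≤-refl i≤n))
    where open IsFirstMax (q₋-firstMax A ℓ)

  -- Whether the maximiser of U lies in the head or in the tail decides where f_ℓ and e_ℓ move a unit.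
  module HeadLeft {ℓ} (ℓ<i : ℓ < i) (T : Array) (x : ℕ → ℕ)
                  (tail< : ∀ q → suc i ≤ q → q ≤ n → W (suc i) T ℓ q < x (suc ℓ) + tailSum T (suc ℓ)) where
    private
      A : Array
      A = withHead T x
      beyond : ∀ q → i < q → q ≤ n → W i A ℓ q < W i A ℓ i
      beyond q i<q q≤n = subst₂ _<_ (sym (W-withHead-tail T x ℓ i<q)) (sym (W-withHead-head T x ℓ)) (+-monoʳ-< (x ℓ) (tail< q i<q q≤n))
      head-lastMax : IsLastMax (W i A ℓ) i n i
      head-lastMax = lastMax ≤-refl i≤n
        (λ q i≤q q≤n → [ (λ i<q → <⇒≤ (beyond q i<q q≤n)) , (λ { refl → ≤-refl }) ]′ (m≤n⇒m<n∨m≡n i≤q)) beyond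

    p₋≡i : p₋ A ℓ ≡ i
    p₋≡i = largestMax≡ i≤n head-lastMax

    φ≡ : φ ℓ A + (x ℓ + tailSum T ℓ) ≡ x ℓ + (x (suc ℓ) + tailSum T (suc ℓ))
    φ≡ = begin
      φ ℓ A + (x ℓ + tailSum T ℓ)    ≡⟨ cong (φ ℓ A +_) (sym (rowSum-withHead T x ℓ)) ⟩
      φ ℓ A + sumR i n (λ j → A ℓ j) ≡⟨ φ-value ℓ<i A ⟩
      W i A ℓ (p₋ A ℓ)               ≡⟨ cong (W i A ℓ) p₋≡i ⟩
      W i A ℓ i                      ≡⟨ W-withHead-head T x ℓ ⟩
      x ℓ + (x (suc ℓ) + tailSum T (suc ℓ)) ∎
      where open ≡-Reasoning

    fMove≡ : fMove ℓ A ≡ moveLeft ℓ i A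
    fMove≡ = trans (Below.fMove≡ ℓ<i A) (cong (λ p → moveLeft ℓ p A) p₋≡i)

  module TailLeft {ℓ} (ℓ<i : ℓ < i) (i<n : i < n) (T : Array) (x : ℕ → ℕ)
                  (head≤ : x (suc ℓ) + tailSum T (suc ℓ) ≤ W (suc i) T ℓ (tailLast T ℓ)) where
    private
      A : Array
      A = withHead T x
      P : ℕ
      P = tailLast T ℓ
      open IsLastMax (largestMax-correct (W (suc i) T ℓ) i<n)
      W-P : W i A ℓ P ≡ x ℓ + W (suc i) T ℓ P
      W-P = W-withHead-tail T x ℓ lower
      tail-lastMax : IsLastMax (W i A ℓ) i n P
      tail-lastMax = lastMax (≤-trans (n≤1+n i) lower) upper maximal′ beyond′
        where
        maximal′ : ∀ q → i ≤ q → q ≤ n → W i A ℓ q ≤ W i A ℓ P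
        maximal′ q i≤q q≤n with m≤n⇒m<n∨m≡n i≤q
        ... | inj₁ i<q = subst₂ _≤_ (sym (W-withHead-tail T x ℓ i<q)) (sym W-P) (+-monoʳ-≤ (x ℓ) (maximal q i<q q≤n))
        ... | inj₂ refl = subst₂ _≤_ (sym (W-withHead-head T x ℓ)) (sym W-P) (+-monoʳ-≤ (x ℓ) head≤)
        beyond′ : ∀ q → P < q → q ≤ n → W i A ℓ q < W i A ℓ P
        beyond′ q P<q q≤n =
          subst₂ _<_ (sym (W-withHead-tail T x ℓ (≤-trans lower (<⇒≤ P<q)))) (sym W-P) (+-monoʳ-< (x ℓ) (beyond q P<q q≤n))

    p₋≡ : p₋ A ℓ ≡ P
    p₋≡ = largestMax≡ i≤n tail-lastMax

    φ≡ : φ ℓ A + (x ℓ + tailSum T ℓ) ≡ x ℓ + W (suc i) T ℓ P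
    φ≡ = trans (cong (φ ℓ A +_) (sym (rowSum-withHead T x ℓ))) (trans (φ-value ℓ<i A) (trans (cong (W i A ℓ) p₋≡) W-P))

    fMove≈ : fMove ℓ A ≈ withHead (tailLeft ℓ T) x
    fMove≈ rewrite Below.fMove≡ ℓ<i A | p₋≡ = moveLeft-setRow-off ℓ T x (>⇒≢ lower)

  module HeadRight {ℓ} (ℓ<i : ℓ < i) (T : Array) (x : ℕ → ℕ)
                   (tail≤ : ∀ q → suc i ≤ q → q ≤ n → W (suc i) T ℓ q ≤ x (suc ℓ) + tailSum T (suc ℓ)) where
    private
      A : Array
      A = withHead T x
      head-firstMax : IsFirstMax (W i A ℓ) i n i
      head-firstMax = firstMax ≤-refl i≤n maximal (λ q i≤q q<i → ⊥-elim (<⇒≱ q<i i≤q))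
        where
        maximal : ∀ q → i ≤ q → q ≤ n → W i A ℓ q ≤ W i A ℓ i
        maximal q i≤q q≤n with m≤n⇒m<n∨m≡n i≤q
        ... | inj₁ i<q = subst₂ _≤_ (sym (W-withHead-tail T x ℓ i<q)) (sym (W-withHead-head T x ℓ)) (+-monoʳ-≤ (x ℓ) (tail≤ q i<q q≤n))
        ... | inj₂ refl = ≤-refl

    q₋≡i : q₋ A ℓ ≡ i
    q₋≡i = smallestMax≡ i≤n head-firstMax

    ε≡ : ε ℓ A ≡ x ℓ
    ε≡ = +-cancelʳ-≡ (sumR i n (λ j → A (suc ℓ) j)) (ε ℓ A) (x ℓ) (begin
      ε ℓ A + sumR i n (λ j → A (suc ℓ) j)  ≡⟨ ε-value ℓ<i A ⟩
      W i A ℓ (q₋ A ℓ)                       ≡⟨ cong (W i A ℓ) q₋≡i ⟩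
      W i A ℓ i                              ≡⟨ W-withHead-head T x ℓ ⟩
      x ℓ + (x (suc ℓ) + tailSum T (suc ℓ))  ≡⟨ cong (x ℓ +_) (sym (rowSum-withHead T x (suc ℓ))) ⟩
      x ℓ + sumR i n (λ j → A (suc ℓ) j)     ∎)
      where open ≡-Reasoning

    eMove≡ : eMove ℓ A ≡ moveRight ℓ i A
    eMove≡ = trans (Below.eMove≡ ℓ<i A) (cong (λ p → moveRight ℓ p A) q₋≡i)

  module TailRight {ℓ} (ℓ<i : ℓ < i) (i<n : i < n) (T : Array) (x : ℕ → ℕ)
                   (head< : x (suc ℓ) + tailSum T (suc ℓ) < W (suc i) T ℓ (tailFirst T ℓ)) where
    private
      A : Array
      A = withHead T x
      P : ℕ
      P = tailFirst T ℓ
      open IsFirstMax (smallestMax-correct (W (suc i) T ℓ) i<n)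
      W-P : W i A ℓ P ≡ x ℓ + W (suc i) T ℓ P
      W-P = W-withHead-tail T x ℓ lower
      tail-firstMax : IsFirstMax (W i A ℓ) i n P
      tail-firstMax = firstMax (≤-trans (n≤1+n i) lower) upper maximal′ before′
        where
        maximal′ : ∀ q → i ≤ q → q ≤ n → W i A ℓ q ≤ W i A ℓ P
        maximal′ q i≤q q≤n with m≤n⇒m<n∨m≡n i≤q
        ... | inj₁ i<q = subst₂ _≤_ (sym (W-withHead-tail T x ℓ i<q)) (sym W-P) (+-monoʳ-≤ (x ℓ) (maximal q i<q q≤n))
        ... | inj₂ refl = subst₂ _≤_ (sym (W-withHead-head T x ℓ)) (sym W-P) (+-monoʳ-≤ (x ℓ) (<⇒≤ head<))
        before′ : ∀ q → i ≤ q → q < P → W i A ℓ q < W i A ℓ P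
        before′ q i≤q q<P with m≤n⇒m<n∨m≡n i≤q
        ... | inj₁ i<q = subst₂ _<_ (sym (W-withHead-tail T x ℓ i<q)) (sym W-P) (+-monoʳ-< (x ℓ) (before q i<q q<P))
        ... | inj₂ refl = subst₂ _<_ (sym (W-withHead-head T x ℓ)) (sym W-P) (+-monoʳ-< (x ℓ) head<)

    q₋≡ : q₋ A ℓ ≡ P
    q₋≡ = smallestMax≡ i≤n tail-firstMax

    ε≡ : ε ℓ A + (x (suc ℓ) + tailSum T (suc ℓ)) ≡ x ℓ + W (suc i) T ℓ P
    ε≡ = trans (cong (ε ℓ A +_) (sym (rowSum-withHead T x (suc ℓ)))) (trans (ε-value ℓ<i A) (trans (cong (W i A ℓ) q₋≡) W-P))

    eMove≈ : eMove ℓ A ≈ withHead (tailRight ℓ T) x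
    eMove≈ rewrite Below.eMove≡ ℓ<i A | q₋≡ = moveRight-setRow-off ℓ T x (>⇒≢ lower)

module Tail (n i m : ℕ) (1≤i : 1 ≤ i) (i≤n : i ≤ n) where
  open Crystal n i m
  open Operators n i m
  open ColumnPair n
  open HeadTail n i m 1≤i i≤n

  tailMax-ub : ∀ T ℓ {q} → suc i ≤ q → q ≤ n → W (suc i) T ℓ q ≤ tailMax T ℓ
  tailMax-ub T ℓ = maxR-ub (W (suc i) T ℓ)

  tailMax≡last : i < n → ∀ T ℓ → tailMax T ℓ ≡ W (suc i) T ℓ (tailLast T ℓ)
  tailMax≡last i<n T ℓ = ≤-antisym (maxR-lub (W (suc i) T ℓ) maximal) (tailMax-ub T ℓ lower upper)
    where open IsLastMax (largestMax-correct (W (suc i) T ℓ) i<n)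

  tailMax≡first : i < n → ∀ T ℓ → W (suc i) T ℓ (tailFirst T ℓ) ≡ tailMax T ℓ
  tailMax≡first i<n T ℓ =
    trans (sym (lastMax-firstMax-value (largestMax-correct (W (suc i) T ℓ) i<n) (smallestMax-correct (W (suc i) T ℓ) i<n)))
          (sym (tailMax≡last i<n T ℓ))

  tailSum-empty : i ≡ n → ∀ T c → tailSum T c ≡ 0
  tailSum-empty refl T c = sumR-empty {suc i} {i} (λ j → T c j) ≤-refl

  tailMax-empty : i ≡ n → ∀ T ℓ → tailMax T ℓ ≡ 0
  tailMax-empty refl T ℓ = maxR-empty {suc i} {i} (W (suc i) T ℓ) ≤-refl

  tailSum≤tailMax : ∀ T ℓ → tailSum T ℓ ≤ tailMax T ℓ
  tailSum≤tailMax T ℓ with m≤n⇒m<n∨m≡n i≤n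
  ... | inj₁ i<n = ≤-trans (m≤m+n _ _) (tailMax-ub T ℓ i<n ≤-refl)
  ... | inj₂ i≡n = ≤-reflexive (trans (tailSum-empty i≡n T ℓ) (sym (tailMax-empty i≡n T ℓ)))

  tailSum-next≤tailMax : ∀ T ℓ → tailSum T (suc ℓ) ≤ tailMax T ℓ
  tailSum-next≤tailMax T ℓ with m≤n⇒m<n∨m≡n i≤n
  ... | inj₁ i<n = ≤-trans (m≤n+m _ _) (tailMax-ub T ℓ ≤-refl i<n)
  ... | inj₂ i≡n = ≤-reflexive (trans (tailSum-empty i≡n T (suc ℓ)) (sym (tailMax-empty i≡n T ℓ)))

  module TailStep (i<n : i < n) (T : Array) (ℓ : ℕ) (unsaturated : tailSum T ℓ < tailMax T ℓ) where
    P : ℕ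
    P = tailLast T ℓ
    P-lastMax : IsLastMax (W (suc i) T ℓ) (suc i) n P
    P-lastMax = largestMax-correct (W (suc i) T ℓ) i<n
    open IsLastMax P-lastMax public using () renaming (lower to 1+i≤P; upper to P≤n)

    source-pos : 0 < T (suc ℓ) P
    source-pos = lastMax-source-pos T ℓ P-lastMax (subst (tailSum T ℓ <_) (tailMax≡last i<n T ℓ) unsaturated)

    private
      module M = MoveLeft T ℓ 1+i≤P P≤n source-pos
      T′ : Array
      T′ = tailLeft ℓ T
      P-firstMax : IsFirstMax (W (suc i) T′ ℓ) (suc i) n P
      P-firstMax = M.lastMax⇒firstMax P-lastMax

    tailFirst-after : tailFirst T′ ℓ ≡ P
    tailFirst-after = smallestMax≡ i<n P-firstMax

    tailRight-tailLeft : tailRight ℓ T′ ≈ T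
    tailRight-tailLeft rewrite tailFirst-after = moveRight-moveLeft ℓ P T source-pos

    tailMax-after : tailMax T′ ℓ ≡ tailMax T ℓ
    tailMax-after = begin
      tailMax T′ ℓ                ≡⟨ tailMax≡last i<n T′ ℓ ⟩
      W (suc i) T′ ℓ (tailLast T′ ℓ) ≡⟨ lastMax-firstMax-value (largestMax-correct (W (suc i) T′ ℓ) i<n) P-firstMax ⟩
      W (suc i) T′ ℓ P            ≡⟨ M.W-at ⟩
      W (suc i) T ℓ P             ≡⟨ sym (tailMax≡last i<n T ℓ) ⟩
      tailMax T ℓ                 ∎
      where open ≡-Reasoning

    tailSum-after : tailSum T′ ℓ ≡ suc (tailSum T ℓ)
    tailSum-after = M.rowℓ-grows 1+i≤P P≤n

    tailSum-next-after : suc (tailSum T′ (suc ℓ)) ≡ tailSum T (suc ℓ)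
    tailSum-next-after = M.rowℓ+1-shrinks 1+i≤P P≤n

  record Saturating (T T′ : Array) (ℓ r : ℕ) : Set where
    field
      max-same     : tailMax T′ ℓ ≡ tailMax T ℓ
      sum-grows    : tailSum T′ ℓ ≡ tailSum T ℓ + r
      next-shrinks : tailSum T′ (suc ℓ) + r ≡ tailSum T (suc ℓ)

  saturating : i < n → ∀ T ℓ r → tailSum T ℓ + r ≤ tailMax T ℓ → Saturating T ((tailLeft ℓ ^ r) T) ℓ r
  unsaturated : i < n → ∀ T ℓ r → tailSum T ℓ + suc r ≤ tailMax T ℓ → tailSum ((tailLeft ℓ ^ r) T) ℓ < tailMax ((tailLeft ℓ ^ r) T) ℓ

  saturating i<n T ℓ zero _ = record { max-same = refl ; sum-grows = sym (+-identityʳ _) ; next-shrinks = +-identityʳ _ }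
  saturating i<n T ℓ (suc r) room = record
    { max-same     = trans S.tailMax-after max-same
    ; sum-grows    = trans S.tailSum-after (trans (cong suc sum-grows) (sym (+-suc _ r)))
    ; next-shrinks = trans (+-suc _ r) (trans (cong (_+ r) S.tailSum-next-after) next-shrinks)
    }
    where
    open Saturating (saturating i<n T ℓ r (≤-trans (+-monoʳ-≤ (tailSum T ℓ) (n≤1+n r)) room))
    module S = TailStep i<n ((tailLeft ℓ ^ r) T) ℓ (unsaturated i<n T ℓ r room)

  unsaturated i<n T ℓ r room = subst₂ _<_ (sym sum-grows) (sym max-same) (subst (_≤ tailMax T ℓ) (+-suc (tailSum T ℓ) r) room)
    where open Saturating (saturating i<n T ℓ r (≤-trans (+-monoʳ-≤ (tailSum T ℓ) (n≤1+n r)) room))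

-- The phases of F and E

module Phases (n i m : ℕ) (1≤i : 1 ≤ i) (i≤n : i ≤ n) where
  open Crystal n i m
  open Operators n i m
  open ColumnPair n
  open HeadTail n i m 1≤i i≤n
  open Tail n i m 1≤i i≤n

  -- f_ℓ^{φ_ℓ} on an array whose head row is full in column ℓ + 1 and empty in column ℓ:
  -- first m − M units move left inside the head row, then M − tailSum T ℓ units inside the tail.
  module FPhase {ℓ} (ℓ<i : ℓ < i) (T : Array) (x : ℕ → ℕ)
                (x-empty : x ℓ ≡ 0) (x-full : x (suc ℓ) + tailSum T (suc ℓ) ≡ m) (M≤m : tailMax T ℓ ≤ m) where
    M : ℕ
    M = tailMax T ℓ
    Cu : ℕ
    Cu = tailSum T ℓ
    Cv : ℕ
    Cv = tailSum T (suc ℓ)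
    X : ℕ
    X = x (suc ℓ)
    r : ℕ
    r = m ∸ M
    a : ℕ
    a = M ∸ Cu

    r≤X : r ≤ X
    r≤X = subst (r ≤_) m∸Cv≡X (∸-monoʳ-≤ m (tailSum-next≤tailMax T ℓ))
      where
      m∸Cv≡X : m ∸ Cv ≡ X
      m∸Cv≡X = trans (cong (_∸ Cv) (sym x-full)) (m+n∸n≡m X Cv)

    private
      Cu≤M : Cu ≤ M
      Cu≤M = tailSum≤tailMax T ℓ
      X∸j+Cv : ∀ {j} → j ≤ X → (X ∸ j) + Cv ≡ m ∸ j
      X∸j+Cv {j} j≤X = trans (sym (+-∸-comm Cv j≤X)) (cong (_∸ j) x-full)
      head-gap : ∀ {j} → j < r → M < (X ∸ j) + Cv
      head-gap {j} j<r = subst (M <_) (sym (X∸j+Cv (≤-trans (<⇒≤ j<r) r≤X)))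
        (m+n≤o⇒m≤o∸n (suc M) (subst (_≤ m) (cong suc (+-comm j M)) (m≤o∸n⇒m+n≤o (suc j) M≤m j<r)))

    X∸r+Cv≡M : (X ∸ r) + Cv ≡ M
    X∸r+Cv≡M = trans (X∸j+Cv r≤X) (m∸[m∸n]≡n M≤m)

    headRow : ℕ → (ℕ → ℕ)
    headRow j = setPair x ℓ j (X ∸ j)

    head-step : ∀ j → j < r → f ℓ (withHead T (headRow j)) ⇓ withHead T (headRow (suc j))
    head-step j j<r = f-step pos (≈-trans (≡⇒≈ K.fMove≡) (≈-trans (moveLeft-setPair ℓ i T x j (X ∸ j))
                        (setRow-congʳ T i (λ p → cong (λ v → setPair x ℓ (suc j) v p) (m∸n∸1≡m∸[1+n] X j)))))
      where
      dominant : ∀ q → suc i ≤ q → q ≤ n → W (suc i) T ℓ q < headRow j (suc ℓ) + Cv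
      dominant q 1+i≤q q≤n = subst (λ v → W (suc i) T ℓ q < v + Cv) (sym (setPair-snd x ℓ j (X ∸ j)))
                               (≤-<-trans (tailMax-ub T ℓ 1+i≤q q≤n) (head-gap j<r))
      module K = HeadLeft ℓ<i T (headRow j) dominant
      pos : 0 < φ ℓ (withHead T (headRow j))
      pos = m+n≡o∧n<o⇒0<m K.φ≡ (subst (λ v → v + Cu < v + (headRow j (suc ℓ) + Cv)) (sym (setPair-fst x ℓ j (X ∸ j)))
              (+-monoʳ-< j (subst (λ v → Cu < v + Cv) (sym (setPair-snd x ℓ j (X ∸ j))) (≤-<-trans Cu≤M (head-gap j<r)))))

    head-phase : ∀ j → j ≤ r → fPow ℓ j (withHead T x) ⇓ withHead T (headRow j)
    head-phase j j≤r = ≋-trans (fPow-resp ℓ j start) (fPow-chain ℓ (withHead T ∘ headRow) j (λ s s<j → head-step s (<-≤-trans s<j j≤r)))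
      where
      start : withHead T x ≈ withHead T (headRow 0)
      start = setRow-congʳ T i (λ p → sym (trans (cong (λ v → setPair x ℓ v X p) (sym x-empty)) (setPair-same x ℓ p)))

    tailState : ℕ → Array
    tailState j = withHead ((tailLeft ℓ ^ j) T) (headRow r)

    tail-step : ∀ j → j < a → f ℓ (tailState j) ⇓ tailState (suc j)
    tail-step j j<a with m≤n⇒m<n∨m≡n i≤n
    ... | inj₂ i≡n = ⊥-elim (<⇒≱ j<a (subst (_≤ j) (sym (cong₂ _∸_ (tailMax-empty i≡n T ℓ) (tailSum-empty i≡n T ℓ))) z≤n))
    ... | inj₁ i<n = f-step pos K.fMove≈
      where
      Tj : Array
      Tj = (tailLeft ℓ ^ j) T
      open Saturating (saturating i<n T ℓ j (≤-trans (+-monoʳ-≤ Cu (<⇒≤ j<a)) (≤-reflexive (m+[n∸m]≡n Cu≤M))))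
      top≡M : W (suc i) Tj ℓ (tailLast Tj ℓ) ≡ M
      top≡M = trans (sym (tailMax≡last i<n Tj ℓ)) max-same
      head≡M : headRow r (suc ℓ) + Cv ≡ M
      head≡M = trans (cong (_+ Cv) (setPair-snd x ℓ r (X ∸ r))) X∸r+Cv≡M
      head≤ : headRow r (suc ℓ) + tailSum Tj (suc ℓ) ≤ W (suc i) Tj ℓ (tailLast Tj ℓ)
      head≤ = subst₂ _≤_ refl (sym top≡M) (subst (headRow r (suc ℓ) + tailSum Tj (suc ℓ) ≤_) head≡M
                (+-monoʳ-≤ (headRow r (suc ℓ)) (subst (tailSum Tj (suc ℓ) ≤_) next-shrinks (m≤m+n _ j))))
      module K = TailLeft ℓ<i i<n Tj (headRow r) head≤
      pos : 0 < φ ℓ (tailState j)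
      pos = m+n≡o∧n<o⇒0<m K.φ≡ (subst₂ _<_ (cong (headRow r ℓ +_) (sym sum-grows)) (cong (headRow r ℓ +_) (sym top≡M))
              (+-monoʳ-< (headRow r ℓ) (subst (Cu + j <_) (m+[n∸m]≡n Cu≤M) (+-monoʳ-< Cu j<a))))

    φ-start : φ ℓ (withHead T x) ≡ r + a
    φ-start = +-cancelʳ-≡ Cu (φ ℓ A) (r + a) (trans φ+Cu≡m (sym r+a+Cu≡m))
      where
      A : Array
      A = withHead T x
      open IsLastMax (p₋-lastMax A ℓ)
      W-head≡m : W i A ℓ i ≡ m
      W-head≡m = trans (W-withHead-head T x ℓ) (trans (cong (_+ (X + Cv)) x-empty) x-full)
      W-top≤m : W i A ℓ (p₋ A ℓ) ≤ m
      W-top≤m with m≤n⇒m<n∨m≡n lower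
      ... | inj₁ i<p = subst (_≤ m) (sym (trans (W-withHead-tail T x ℓ i<p) (cong (_+ W (suc i) T ℓ (p₋ A ℓ)) x-empty)))
                         (≤-trans (tailMax-ub T ℓ i<p upper) M≤m)
      ... | inj₂ i≡p = ≤-reflexive (trans (cong (W i A ℓ) (sym i≡p)) W-head≡m)
      φ+Cu≡m : φ ℓ A + Cu ≡ m
      φ+Cu≡m = begin
        φ ℓ A + Cu                       ≡⟨ cong (φ ℓ A +_) (sym (trans (rowSum-withHead T x ℓ) (cong (_+ Cu) x-empty))) ⟩
        φ ℓ A + sumR i n (λ j → A ℓ j)   ≡⟨ φ-value ℓ<i A ⟩
        W i A ℓ (p₋ A ℓ)                 ≡⟨ ≤-antisym W-top≤m (subst (_≤ W i A ℓ (p₋ A ℓ)) W-head≡m (maximal i ≤-refl i≤n)) ⟩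
        m                                ∎
        where open ≡-Reasoning
      r+a+Cu≡m : r + a + Cu ≡ m
      r+a+Cu≡m = trans (+-assoc r a Cu) (trans (cong (r +_) (m∸n+n≡m Cu≤M)) (m∸n+n≡m M≤m))

    result : fMax ℓ (withHead T x) ⇓ tailState a
    result rewrite φ-start | fPow-+ ℓ r a (withHead T x) =
      >>=-⇓ (head-phase r ≤-refl) (fPow-resp ℓ a) (fPow-chain ℓ tailState a tail-step)

  -- e_ℓ^{ε_ℓ − c} after an f-phase: the tail moves are undone first, then z ℓ − c units move right in the head row.
  module EPhase {ℓ} (ℓ<i : ℓ < i) (T : Array) (z : ℕ → ℕ)
                (z-top : z (suc ℓ) + tailSum T (suc ℓ) ≡ tailMax T ℓ) (c : ℕ) (c≤z : c ≤ z ℓ) where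
    M : ℕ
    M = tailMax T ℓ
    Cu : ℕ
    Cu = tailSum T ℓ
    Cv : ℕ
    Cv = tailSum T (suc ℓ)
    a : ℕ
    a = M ∸ Cu

    private
      Cu≤M : Cu ≤ M
      Cu≤M = tailSum≤tailMax T ℓ
      Tk : ℕ → Array
      Tk k = (tailLeft ℓ ^ k) T

    tail-undo : ∀ k → k ≤ a → (ε ℓ (withHead (Tk k) z) ≡ z ℓ + k) × (ePow ℓ k (withHead (Tk k) z) ⇓ withHead T z)
    tail-undo zero _ = trans K.ε≡ (sym (+-identityʳ (z ℓ))) , just ≈-refl
      where
      module K = HeadRight ℓ<i T z (λ q 1+i≤q q≤n → subst (W (suc i) T ℓ q ≤_) (sym z-top) (tailMax-ub T ℓ 1+i≤q q≤n))
    tail-undo (suc k) 1+k≤a with m≤n⇒m<n∨m≡n i≤n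
    ... | inj₂ i≡n = ⊥-elim (<⇒≱ 1+k≤a (subst (_≤ k) (sym (cong₂ _∸_ (tailMax-empty i≡n T ℓ) (tailSum-empty i≡n T ℓ))) z≤n))
    ... | inj₁ i<n = ε≡ , >>=-⇓ (e-step pos (≈-trans K.eMove≈ (setRow-cong i z S.tailRight-tailLeft))) (ePow-resp ℓ k)
                                (proj₂ (tail-undo k (≤-trans (n≤1+n k) 1+k≤a)))
      where
      room : Cu + suc k ≤ M
      room = ≤-trans (+-monoʳ-≤ Cu 1+k≤a) (≤-reflexive (m+[n∸m]≡n Cu≤M))
      open Saturating (saturating i<n T ℓ (suc k) room)
      module S = TailStep i<n (Tk k) ℓ (unsaturated i<n T ℓ k room)
      top≡M : W (suc i) (Tk (suc k)) ℓ (tailFirst (Tk (suc k)) ℓ) ≡ M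
      top≡M = trans (tailMax≡first i<n (Tk (suc k)) ℓ) max-same
      Zs : ℕ
      Zs = z (suc ℓ) + tailSum (Tk (suc k)) (suc ℓ)
      Zs+1+k≡M : Zs + suc k ≡ M
      Zs+1+k≡M = trans (+-assoc (z (suc ℓ)) _ (suc k)) (trans (cong (z (suc ℓ) +_) next-shrinks) z-top)
      module K = TailRight ℓ<i i<n (Tk (suc k)) z (subst (Zs <_) (sym top≡M) (subst (Zs <_) Zs+1+k≡M (m<m+n Zs z<s)))
      ε≡ : ε ℓ (withHead (Tk (suc k)) z) ≡ z ℓ + suc k
      ε≡ = +-cancelʳ-≡ Zs _ _ (begin
        ε ℓ (withHead (Tk (suc k)) z) + Zs  ≡⟨ K.ε≡ ⟩
        z ℓ + W (suc i) (Tk (suc k)) ℓ (tailFirst (Tk (suc k)) ℓ) ≡⟨ cong (z ℓ +_) (trans top≡M (sym Zs+1+k≡M)) ⟩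
        z ℓ + (Zs + suc k)                   ≡⟨ cong (z ℓ +_) (+-comm Zs (suc k)) ⟩
        z ℓ + (suc k + Zs)                   ≡⟨ sym (+-assoc (z ℓ) (suc k) Zs) ⟩
        z ℓ + suc k + Zs                     ∎)
        where open ≡-Reasoning
      pos : 0 < ε ℓ (withHead (Tk (suc k)) z)
      pos = subst (0 <_) (sym (trans ε≡ (+-suc (z ℓ) k))) z<s

    headRow : ℕ → (ℕ → ℕ)
    headRow j = setPair z ℓ (z ℓ ∸ j) (z (suc ℓ) + j)

    head-step : ∀ j → j < z ℓ ∸ c → e ℓ (withHead T (headRow j)) ⇓ withHead T (headRow (suc j))
    head-step j j<z∸c = e-step pos (≈-trans (≡⇒≈ K.eMove≡) (≈-trans (moveRight-setPair ℓ i T z (z ℓ ∸ j) (z (suc ℓ) + j))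
                          (setRow-congʳ T i (λ p → cong₂ (λ u v → setPair z ℓ u v p) (m∸n∸1≡m∸[1+n] (z ℓ) j) (sym (+-suc (z (suc ℓ)) j))))))
      where
      dominant : ∀ q → suc i ≤ q → q ≤ n → W (suc i) T ℓ q ≤ headRow j (suc ℓ) + Cv
      dominant q 1+i≤q q≤n = ≤-trans (tailMax-ub T ℓ 1+i≤q q≤n) (subst₂ _≤_ z-top (cong (_+ Cv) (sym (setPair-snd z ℓ _ _)))
                               (+-monoˡ-≤ Cv (m≤m+n (z (suc ℓ)) j)))
      module K = HeadRight ℓ<i T (headRow j) dominant
      pos : 0 < ε ℓ (withHead T (headRow j))
      pos = subst (0 <_) (sym (trans K.ε≡ (setPair-fst z ℓ _ _))) (m<n⇒0<n∸m (<-≤-trans j<z∸c (m∸n≤m (z ℓ) c)))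

    head-phase : ePow ℓ (z ℓ ∸ c) (withHead T z) ⇓ withHead T (headRow (z ℓ ∸ c))
    head-phase = ≋-trans (ePow-resp ℓ (z ℓ ∸ c) start) (ePow-chain ℓ (withHead T ∘ headRow) (z ℓ ∸ c) head-step)
      where
      start : withHead T z ≈ withHead T (headRow 0)
      start = setRow-congʳ T i (λ p → sym (trans (cong (λ v → setPair z ℓ (z ℓ) v p) (+-identityʳ _)) (setPair-same z ℓ p)))

    result : ePow ℓ (ε ℓ (withHead (Tk a) z) ∸ c) (withHead (Tk a) z) ⇓ withHead T (setPair z ℓ c (z (suc ℓ) + (z ℓ ∸ c)))
    result rewrite proj₁ (tail-undo a ≤-refl) | +-comm (z ℓ) a | +-∸-assoc a c≤z | ePow-+ ℓ a (z ℓ ∸ c) (withHead (Tk a) z) =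
      ⇓-≈ (>>=-⇓ (proj₂ (tail-undo a ≤-refl)) (ePow-resp ℓ (z ℓ ∸ c)) head-phase)
          (setRow-congʳ T i (λ p → cong (λ u → setPair z ℓ u (z (suc ℓ) + (z ℓ ∸ c)) p) (m∸[m∸n]≡n c≤z)))

  module FiPhase (T : Array) (x : ℕ → ℕ) (x-zero : ∀ j → j ≤ i → x j ≡ 0) (room : tailSum T i ≤ m) where
    φ-at : ∀ v → φ i (withHead T (setAt x i v)) ≡ m ∸ (v + tailSum T i)
    φ-at v = begin
      φ i (withHead T (setAt x i v))
        ≡⟨ At.φ≡ (withHead T (setAt x i v)) ⟩
      (m ∸ sumR 1 (i ∸ 1) (λ j → withHead T (setAt x i v) j i)) ∸ sumR i n (λ j → withHead T (setAt x i v) i j)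
        ≡⟨ cong₂ (λ s t → (m ∸ s) ∸ t) left-empty (trans (rowSum-withHead T (setAt x i v) i) (cong (_+ tailSum T i) (setAt-at x i v))) ⟩
      m ∸ (v + tailSum T i) ∎
      where
      open ≡-Reasoning
      left-empty : sumR 1 (i ∸ 1) (λ j → withHead T (setAt x i v) j i) ≡ 0
      left-empty = sumR-zero 1 (i ∸ 1) (λ j _ j≤i-1 → trans (setRow-at T i (setAt x i v) j)
                     (trans (setAt-off x v (<⇒≢ (≤-<-trans j≤i-1 (∸-monoʳ-< z<s 1≤i)))) (x-zero j (≤-trans j≤i-1 (m∸n≤m i 1)))))

    step : ∀ j → j < m ∸ tailSum T i → f i (withHead T (setAt x i j)) ⇓ withHead T (setAt x i (suc j))
    step j j<room = f-step pos (≈-trans (≡⇒≈ (At.fMove≡ (withHead T (setAt x i j))))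
                      (inc-setRow i i T (trans (setAt-at x i (suc j)) (cong suc (sym (setAt-at x i j))))
                                        (λ p p≢i → trans (setAt-off x (suc j) p≢i) (sym (setAt-off x j p≢i)))))
      where
      pos : 0 < φ i (withHead T (setAt x i j))
      pos = subst (0 <_) (sym (φ-at j)) (m<n⇒0<n∸m (subst (j + tailSum T i <_) (m∸n+n≡m room) (+-monoˡ-< (tailSum T i) j<room)))

    private
      start : withHead T x ≈ withHead T (setAt x i 0)
      start = setRow-congʳ T i (λ p → sym (trans (cong (λ v → setAt x i v p) (sym (x-zero i ≤-refl))) (setAt-same x i p)))

    power : ∀ j → j ≤ m ∸ tailSum T i → fPow i j (withHead T x) ⇓ withHead T (setAt x i j)
    power j j≤room =
      ≋-trans (fPow-resp i j start) (fPow-chain i (λ j → withHead T (setAt x i j)) j (λ s s<j → step s (<-≤-trans s<j j≤room)))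

    result : fMax i (withHead T x) ⇓ withHead T (setAt x i (m ∸ tailSum T i))
    result rewrite φ-cong i start | φ-at 0 = power (m ∸ tailSum T i) ≤-refl

  module EiPhase (T : Array) (z : ℕ → ℕ) (c : ℕ) (c≤z : c ≤ z i) where
    private
      row : ℕ → (ℕ → ℕ)
      row j = setAt z i (z i ∸ j)

    step : ∀ j → j < z i ∸ c → e i (withHead T (row j)) ⇓ withHead T (row (suc j))
    step j j<z∸c = e-step pos (≈-trans (≡⇒≈ (At.eMove≡ (withHead T (row j))))
                     (dec-setRow i i T (trans (setAt-at z i (z i ∸ suc j)) (sym (trans (cong (_∸ 1) (setAt-at z i (z i ∸ j))) (m∸n∸1≡m∸[1+n] (z i) j))))
                                       (λ p p≢i → trans (setAt-off z (z i ∸ suc j) p≢i) (sym (setAt-off z (z i ∸ j) p≢i)))))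
      where
      pos : 0 < ε i (withHead T (row j))
      pos = subst (0 <_) (sym (trans (At.ε≡ (withHead T (row j))) (trans (setRow-at T i (row j) i) (setAt-at z i (z i ∸ j)))))
                  (m<n⇒0<n∸m (<-≤-trans j<z∸c (m∸n≤m (z i) c)))

    result : ePow i (ε i (withHead T z) ∸ c) (withHead T z) ⇓ withHead T (setAt z i c)
    result rewrite At.ε≡ (withHead T z) | setRow-at T i z i =
      ⇓-≈ (≋-trans (ePow-resp i (z i ∸ c) start) (ePow-chain i (withHead T ∘ row) (z i ∸ c) step))
          (setRow-congʳ T i (λ p → cong (λ v → setAt z i v p) (m∸[m∸n]≡n c≤z)))
      where
      start : withHead T z ≈ withHead T (row 0)
      start = setRow-congʳ T i (λ p → sym (setAt-same z i p))

  saturated : ∀ T ℓ → tailSum ((tailLeft ℓ ^ (tailMax T ℓ ∸ tailSum T ℓ)) T) ℓ ≡ tailMax T ℓ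
  saturated T ℓ with m≤n⇒m<n∨m≡n i≤n
  ... | inj₁ i<n = trans (Saturating.sum-grows (saturating i<n T ℓ _ (≤-reflexive (m+[n∸m]≡n (tailSum≤tailMax T ℓ)))))
                         (m+[n∸m]≡n (tailSum≤tailMax T ℓ))
  ... | inj₂ i≡n rewrite tailMax-empty i≡n T ℓ | tailSum-empty i≡n T ℓ = tailSum-empty i≡n T ℓ

  -- E ∘ F unfolds from the outside in: e_L^{ε_L − c_L} ∘ (the composite for L − 1) ∘ f_L^{φ_L}.
  -- Inv abstracts the invariant of the tail; its two properties come from the Dyck path bounds.
  module Composite (t : ℕ) (c : ℕ → ℕ) (1≤t : 1 ≤ t) (c-before : ∀ j → j < t → c j ≡ 0)
                   (Inv : ℕ → Array → Set)
                   (bound : ∀ L T → t ≤ L → L < i → Inv L T → tailMax T L + sumR 1 L c ≤ m)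
                   (preserved : ∀ L T → Inv (suc L) T → Inv L ((tailLeft (suc L) ^ (tailMax T (suc L) ∸ tailSum T (suc L))) T)) where

    C : ℕ → ℕ
    C L = sumR 1 L c

    eLayer : ℕ → Array → Maybe Array
    eLayer ℓ B = ePow ℓ (ε ℓ B ∸ c ℓ) B

    EF : ℕ → Array → Maybe Array
    EF L A = (applySeq (reverse (range (suc t) L)) fMax A >>= fPow t (c t)) >>= applySeq (range (suc t) L) eLayer

    EF-suc : ∀ L A → t ≤ L → EF (suc L) A ≡ ((fMax (suc L) A >>= EF L) >>= eLayer (suc L))
    EF-suc L A t≤L rewrite range-snoc {suc t} {L} (s≤s t≤L) | reverse-++ (range (suc t) L) [ suc L ] = begin
      (((fMax (suc L) A >>= F′) >>= fPow t (c t)) >>= E′)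
        ≡⟨ cong (_>>= E′) (bind-assoc (fMax (suc L) A) F′ (fPow t (c t))) ⟩
      ((fMax (suc L) A >>= (λ B → F′ B >>= fPow t (c t))) >>= E′)
        ≡⟨ bind-assoc (fMax (suc L) A) (λ B → F′ B >>= fPow t (c t)) E′ ⟩
      (fMax (suc L) A >>= (λ B → (F′ B >>= fPow t (c t)) >>= E′))
        ≡⟨ bind-cong (fMax (suc L) A) split-E ⟩
      (fMax (suc L) A >>= (λ B → EF L B >>= eLayer (suc L)))
        ≡⟨ sym (bind-assoc (fMax (suc L) A) (EF L) (eLayer (suc L))) ⟩
      ((fMax (suc L) A >>= EF L) >>= eLayer (suc L)) ∎
      where
      open ≡-Reasoning
      F′ : Array → Maybe Array
      F′ = applySeq (reverse (range (suc t) L)) fMax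
      E′ : Array → Maybe Array
      E′ = applySeq (range (suc t) L ++ [ suc L ]) eLayer
      split-E : ∀ B → ((F′ B >>= fPow t (c t)) >>= E′) ≡ (EF L B >>= eLayer (suc L))
      split-E B = begin
        ((F′ B >>= fPow t (c t)) >>= E′)
          ≡⟨ bind-cong (F′ B >>= fPow t (c t)) (λ B′ → applySeq-++ (range (suc t) L) [ suc L ] eLayer B′) ⟩
        ((F′ B >>= fPow t (c t)) >>= (λ B′ → applySeq (range (suc t) L) eLayer B′ >>= applySeq [ suc L ] eLayer))
          ≡⟨ sym (bind-assoc (F′ B >>= fPow t (c t)) (applySeq (range (suc t) L) eLayer) (applySeq [ suc L ] eLayer)) ⟩
        (EF L B >>= applySeq [ suc L ] eLayer)
          ≡⟨ bind-cong (EF L B) (λ B′ → bind-just (eLayer (suc L) B′)) ⟩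
        (EF L B >>= eLayer (suc L)) ∎

    eLayer-resp : ∀ ℓ → Respects≈ (eLayer ℓ)
    eLayer-resp ℓ {A} {B} A≈B rewrite ε-cong ℓ A≈B = ePow-resp ℓ (ε ℓ B ∸ c ℓ) A≈B

    EF-resp : ∀ L → Respects≈ (EF L)
    EF-resp L A≈B = >>=-resp (>>=-resp (applySeq-resp (reverse (range (suc t) L)) fMax fMax-resp A≈B) (fPow-resp t (c t)))
                              (applySeq-resp (range (suc t) L) eLayer eLayer-resp)

    C-suc : ∀ L → C (suc L) ≡ C L + c (suc L)
    C-suc L = sumR-snoc c (s≤s z≤n)

    C-first : C t ≡ c t
    C-first = go t 1≤t c-before
      where
      go : ∀ t → 1 ≤ t → (∀ j → j < t → c j ≡ 0) → C t ≡ c t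
      go (suc t) _ zero-before = trans (C-suc t) (cong (_+ c (suc t)) (sumR-zero 1 t (λ j _ j≤t → zero-before j (s≤s j≤t))))

    record Outcome (L : ℕ) (T : Array) (x : ℕ → ℕ) : Set where
      field
        row      : ℕ → ℕ
        computes : EF L (withHead T x) ⇓ withHead T row
        low      : ∀ j → j ≤ L → row j ≡ c j
        next     : row (suc L) + C L ≡ x (suc L)
        high     : ∀ j → suc L < j → row j ≡ x j

    Layers : ℕ → Set
    Layers L = ∀ T x → Inv L T → (∀ j → j ≤ L → x j ≡ 0) → x (suc L) + tailSum T (suc L) ≡ m → Outcome L T x

    innermost : t < i → Layers t
    innermost t<i T x inv x-zero x-full = record { row = row ; computes = computes ; low = low ; next = next ; high = high }
      where
      M+c≤m : tailMax T t + c t ≤ m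
      M+c≤m = subst (λ v → tailMax T t + v ≤ m) C-first (bound t T ≤-refl t<i inv)
      module F = FPhase t<i T x (x-zero t ≤-refl) x-full (≤-trans (m≤m+n _ _) M+c≤m)
      c≤r : c t ≤ F.r
      c≤r = m+n≤o⇒m≤o∸n (c t) (subst (_≤ m) (+-comm (tailMax T t) (c t)) M+c≤m)
      row : ℕ → ℕ
      row = setPair x t (c t) (x (suc t) ∸ c t)
      computes : EF t (withHead T x) ⇓ withHead T row
      computes rewrite range-nil {suc t} {t} ≤-refl | bind-just (fPow t (c t) (withHead T x)) = F.head-phase (c t) c≤r
      low : ∀ j → j ≤ t → row j ≡ c j
      low j j≤t with m≤n⇒m<n∨m≡n j≤t
      ... | inj₂ refl = setPair-fst x j (c j) _
      ... | inj₁ j<t = trans (setPair-off x _ _ (<⇒≢ j<t) (<⇒≢ (m<n⇒m<1+n j<t))) (trans (x-zero j j≤t) (sym (c-before j j<t)))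
      next : row (suc t) + C t ≡ x (suc t)
      next = trans (cong₂ _+_ (setPair-snd x t (c t) _) C-first) (m∸n+n≡m (≤-trans c≤r F.r≤X))
      high : ∀ j → suc (suc t) ≤ j → row j ≡ x j
      high j 2+t≤j = setPair-off x _ _ (>⇒≢ (≤-trans (n≤1+n _) 2+t≤j)) (>⇒≢ 2+t≤j)
    outer : ∀ L → t ≤ L → suc L < i → Layers L → Layers (suc L)
    outer L t≤L 1+L<i inner T x inv x-zero x-full = record { row = row ; computes = computes ; low = low ; next = next ; high = high }
      where
      ℓ : ℕ
      ℓ = suc L
      M+C≤m : tailMax T ℓ + C ℓ ≤ m
      M+C≤m = bound ℓ T (m≤n⇒m≤1+n t≤L) 1+L<i inv
      module F = FPhase 1+L<i T x (x-zero ℓ ≤-refl) x-full (≤-trans (m≤m+n (tailMax T ℓ) (C ℓ)) M+C≤m)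
      T′ : Array
      T′ = (tailLeft ℓ ^ F.a) T
      x₁ : ℕ → ℕ
      x₁ = F.headRow F.r
      x₁-zero : ∀ j → j ≤ L → x₁ j ≡ 0
      x₁-zero j j≤L = trans (setPair-off x _ _ (<⇒≢ (s≤s j≤L)) (<⇒≢ (m<n⇒m<1+n (s≤s j≤L)))) (x-zero j (m≤n⇒m≤1+n j≤L))
      x₁-full : x₁ ℓ + tailSum T′ ℓ ≡ m
      x₁-full = trans (cong₂ _+_ (setPair-fst x ℓ F.r _) (saturated T ℓ)) (m∸n+n≡m (≤-trans (m≤m+n (tailMax T ℓ) (C ℓ)) M+C≤m))
      module IH = Outcome (inner T′ x₁ (preserved L T inv) x₁-zero x₁-full)
      x₂ : ℕ → ℕ
      x₂ = IH.row
      x₂-next : x₂ (suc ℓ) ≡ F.X ∸ F.r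
      x₂-next = trans (IH.high (suc ℓ) ≤-refl) (setPair-snd x ℓ F.r _)
      x₂+C≡r : x₂ ℓ + C L ≡ F.r
      x₂+C≡r = trans IH.next (setPair-fst x ℓ F.r _)
      c≤x₂ : c ℓ ≤ x₂ ℓ
      c≤x₂ = +-cancelʳ-≤ (C L) (c ℓ) (x₂ ℓ) (subst₂ _≤_ (trans (C-suc L) (+-comm (C L) (c ℓ))) (sym x₂+C≡r)
               (m+n≤o⇒m≤o∸n (C ℓ) (subst (_≤ m) (+-comm (tailMax T ℓ) (C ℓ)) M+C≤m)))
      module E = EPhase 1+L<i T x₂ (trans (cong (_+ F.Cv) x₂-next) F.X∸r+Cv≡M) (c ℓ) c≤x₂
      row : ℕ → ℕ
      row = setPair x₂ ℓ (c ℓ) (x₂ (suc ℓ) + (x₂ ℓ ∸ c ℓ))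
      computes : EF ℓ (withHead T x) ⇓ withHead T row
      computes rewrite EF-suc L (withHead T x) t≤L =
        >>=-⇓ (>>=-⇓ F.result (EF-resp L) IH.computes) (eLayer-resp ℓ) E.result
      low : ∀ j → j ≤ ℓ → row j ≡ c j
      low j j≤ℓ with m≤n⇒m<n∨m≡n j≤ℓ
      ... | inj₂ refl = setPair-fst x₂ j (c j) _
      ... | inj₁ (s≤s j≤L) = trans (setPair-off x₂ _ _ (<⇒≢ (s≤s j≤L)) (<⇒≢ (m<n⇒m<1+n (s≤s j≤L)))) (IH.low j j≤L)
      next : row (suc ℓ) + C ℓ ≡ x (suc ℓ)
      next = begin
        row (suc ℓ) + C ℓ                                    ≡⟨ cong₂ _+_ (setPair-snd x₂ ℓ _ _) (C-suc L) ⟩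
        x₂ (suc ℓ) + (x₂ ℓ ∸ c ℓ) + (C L + c ℓ)              ≡⟨ solve 4 (λ a b d e → a :+ b :+ (d :+ e) := a :+ ((b :+ e) :+ d)) refl
                                                                   (x₂ (suc ℓ)) (x₂ ℓ ∸ c ℓ) (C L) (c ℓ) ⟩
        x₂ (suc ℓ) + ((x₂ ℓ ∸ c ℓ) + c ℓ + C L)              ≡⟨ cong (λ v → x₂ (suc ℓ) + (v + C L)) (m∸n+n≡m c≤x₂) ⟩
        x₂ (suc ℓ) + (x₂ ℓ + C L)                            ≡⟨ cong₂ _+_ x₂-next x₂+C≡r ⟩
        (F.X ∸ F.r) + F.r                                    ≡⟨ m∸n+n≡m F.r≤X ⟩
        x (suc ℓ)                                            ∎
        where open ≡-Reasoning
      high : ∀ j → suc ℓ < j → row j ≡ x j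
      high j 1+ℓ<j = trans (setPair-off x₂ _ _ (>⇒≢ ℓ<j) (>⇒≢ 1+ℓ<j)) (trans (IH.high j ℓ<j) (setPair-off x _ _ (>⇒≢ ℓ<j) (>⇒≢ 1+ℓ<j)))
        where
        ℓ<j : ℓ < j
        ℓ<j = <-trans (n<1+n ℓ) 1+ℓ<j

    layers : ∀ L → t ≤ L → L < i → Layers L
    layers L t≤L L<i with m≤n⇒m<n∨m≡n t≤L
    ... | inj₂ refl = innermost L<i
    layers (suc L) _ 1+L<i | inj₁ (s≤s t≤L) = outer L t≤L 1+L<i (layers L t≤L (<-trans (n<1+n L) 1+L<i))

-- Lattice paths

pathSumBefore : Array → ℕ → ℕ → List Step → ℕ
pathSumBefore A a b []           = 0
pathSumBefore A a b (down ∷ s)  = A a b + pathSumBefore A a (suc b) s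
pathSumBefore A a b (right ∷ s) = A a b + pathSumBefore A (suc a) b s

endCol-++ : ∀ a s t → endCol a (s ++ t) ≡ endCol (endCol a s) t
endCol-++ a []          t = refl
endCol-++ a (down ∷ s)  t = endCol-++ a s t
endCol-++ a (right ∷ s) t = endCol-++ (suc a) s t

endRow-++ : ∀ b s t → endRow b (s ++ t) ≡ endRow (endRow b s) t
endRow-++ b []          t = refl
endRow-++ b (down ∷ s)  t = endRow-++ (suc b) s t
endRow-++ b (right ∷ s) t = endRow-++ b s t

pathSumBefore-++ : ∀ A a b s t → pathSumBefore A a b (s ++ t) ≡ pathSumBefore A a b s + pathSumBefore A (endCol a s) (endRow b s) t
pathSumBefore-++ A a b []          t = refl
pathSumBefore-++ A a b (down ∷ s)  t = trans (cong (A a b +_) (pathSumBefore-++ A a (suc b) s t)) (sym (+-assoc (A a b) _ _))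
pathSumBefore-++ A a b (right ∷ s) t = trans (cong (A a b +_) (pathSumBefore-++ A (suc a) b s t)) (sym (+-assoc (A a b) _ _))

pathSum-++ : ∀ A a b s t → pathSum A a b (s ++ t) ≡ pathSumBefore A a b s + pathSum A (endCol a s) (endRow b s) t
pathSum-++ A a b []          t = refl
pathSum-++ A a b (down ∷ s)  t = trans (cong (A a b +_) (pathSum-++ A a (suc b) s t)) (sym (+-assoc (A a b) _ _))
pathSum-++ A a b (right ∷ s) t = trans (cong (A a b +_) (pathSum-++ A (suc a) b s t)) (sym (+-assoc (A a b) _ _))

pathSumBefore-snoc : ∀ A a b s st → pathSumBefore A a b (s ++ [ st ]) ≡ pathSum A a b s
pathSumBefore-snoc A a b []          down  = +-identityʳ (A a b)
pathSumBefore-snoc A a b []          right = +-identityʳ (A a b)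
pathSumBefore-snoc A a b (down ∷ s)  st    = cong (A a b +_) (pathSumBefore-snoc A a (suc b) s st)
pathSumBefore-snoc A a b (right ∷ s) st    = cong (A a b +_) (pathSumBefore-snoc A (suc a) b s st)

downs rights : ℕ → List Step
downs  r = replicate r down
rights r = replicate r right

endCol-downs : ∀ a r → endCol a (downs r) ≡ a
endCol-downs a zero    = refl
endCol-downs a (suc r) = endCol-downs a r

endRow-downs : ∀ b r → endRow b (downs r) ≡ b + r
endRow-downs b zero    = sym (+-identityʳ b)
endRow-downs b (suc r) = trans (endRow-downs (suc b) r) (sym (+-suc b r))

endCol-rights : ∀ a r → endCol a (rights r) ≡ a + r
endCol-rights a zero    = sym (+-identityʳ a)
endCol-rights a (suc r) = trans (endCol-rights (suc a) r) (sym (+-suc a r))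

endRow-rights : ∀ b r → endRow b (rights r) ≡ b
endRow-rights b zero    = refl
endRow-rights b (suc r) = endRow-rights b r

pathSum-downs : ∀ A a b r → pathSum A a b (downs r) ≡ sumR b (b + r) (λ j → A a j)
pathSum-downs A a b zero    = trans (sym (sumR-single b (λ j → A a j))) (cong (λ z → sumR b z (λ j → A a j)) (sym (+-identityʳ b)))
pathSum-downs A a b (suc r) = trans (cong (A a b +_) (pathSum-downs A a (suc b) r))
  (trans (sym (sumR-cons (λ j → A a j) (≤-trans (m≤m+n b r) (n≤1+n _)))) (cong (λ z → sumR b z (λ j → A a j)) (sym (+-suc b r))))

pathSum-rights : ∀ A a b r → pathSum A a b (rights r) ≡ sumR a (a + r) (λ j → A j b)
pathSum-rights A a b zero    = trans (sym (sumR-single a (λ j → A j b))) (cong (λ z → sumR a z (λ j → A j b)) (sym (+-identityʳ a)))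
pathSum-rights A a b (suc r) = trans (cong (A a b +_) (pathSum-rights A (suc a) b r))
  (trans (sym (sumR-cons (λ j → A j b) (≤-trans (m≤m+n a r) (n≤1+n _)))) (cong (λ z → sumR a z (λ j → A j b)) (sym (+-suc a r))))

pathSumBefore-downs-zero : ∀ A a b r → (∀ j → b ≤ j → j < b + r → A a j ≡ 0) → pathSumBefore A a b (downs r) ≡ 0
pathSumBefore-downs-zero A a b zero    _     = refl
pathSumBefore-downs-zero A a b (suc r) zeros = cong₂ _+_ (zeros b ≤-refl (subst (b <_) (sym (+-suc b r)) (s≤s (m≤m+n b r))))
  (pathSumBefore-downs-zero A a (suc b) r (λ j 1+b≤j j<1+b+r → zeros j (≤-trans (n≤1+n b) 1+b≤j) (subst (j <_) (sym (+-suc b r)) j<1+b+r)))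

module PathBounds (n i m : ℕ) (1≤i : 1 ≤ i) (i≤n : i ≤ n) (Q : Array) (Q∈B : InB n i m Q) (k t : ℕ)
                  (first-row : IsFirstNonzeroRow n i Q k) (first-col : IsFirstNonzeroCol i Q k t) where
  open ColumnPair n
  open HeadTail n i m 1≤i i≤n
  open Tail n i m 1≤i i≤n

  R : Array
  R = zeroRow k Q

  c : ℕ → ℕ
  c p = Q p k

  C : ℕ → ℕ
  C L = sumR 1 L c

  i≤k : i ≤ k
  i≤k = proj₁ first-row

  k≤n : k ≤ n
  k≤n = proj₁ (proj₂ first-row)

  R≤Q : ∀ p q → R p q ≤ Q p q
  R≤Q p q with q ≡ᵇ k
  ... | true  = z≤n
  ... | false = ≤-refl

  R-off : ∀ p {q} → q ≢ k → R p q ≡ Q p q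
  R-off p = setRow-off Q (λ _ → 0) p

  Q-outside : ∀ p q → (p ≡ 0 ⊎ i < p ⊎ q < i ⊎ n < q) → Q p q ≡ 0
  Q-outside = proj₁ Q∈B

  Q-above : ∀ p q → i ≤ q → q < k → Q p q ≡ 0
  Q-above zero    q _   _   = Q-outside zero q (inj₁ refl)
  Q-above (suc p) q i≤q q<k with suc p ≤? i
  ... | yes 1+p≤i = proj₂ (proj₂ (proj₂ first-row)) q i≤q q<k (suc p) (s≤s z≤n) 1+p≤i
  ... | no 1+p≰i  = Q-outside (suc p) q (inj₂ (inj₁ (≰⇒> 1+p≰i)))

  R-above : ∀ p q → i ≤ q → q ≤ k → R p q ≡ 0
  R-above p q i≤q q≤k with m≤n⇒m<n∨m≡n q≤k
  ... | inj₁ q<k  = trans (R-off p (<⇒≢ q<k)) (Q-above p q i≤q q<k)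
  ... | inj₂ refl = setRow-at Q q (λ _ → 0) p

  c-before : ∀ j → j < t → c j ≡ 0
  c-before zero    _   = Q-outside zero k (inj₁ refl)
  c-before (suc j) j<t = proj₂ (proj₂ (proj₂ first-col)) (suc j) (s≤s z≤n) j<t

  c-outside : ∀ j → (j ≡ 0 ⊎ i < j) → c j ≡ 0
  c-outside j (inj₁ refl) = Q-outside 0 k (inj₁ refl)
  c-outside j (inj₂ i<j)  = Q-outside j k (inj₂ (inj₁ i<j))

  module Descend {π a p} (π-col : endCol 1 π ≡ a) (π-row : endRow i π ≡ p) {q} (p≤q : p ≤ q) where
    path : List Step
    path = π ++ downs (q ∸ p)

    col : endCol 1 path ≡ a
    col = trans (endCol-++ 1 π (downs (q ∸ p))) (trans (endCol-downs (endCol 1 π) (q ∸ p)) π-col)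

    row : endRow i path ≡ q
    row = trans (endRow-++ i π (downs (q ∸ p))) (trans (endRow-downs (endRow i π) (q ∸ p)) (trans (cong (_+ (q ∸ p)) π-row) (m+[n∸m]≡n p≤q)))

    weight : pathSum Q 1 i path ≡ pathSumBefore Q 1 i π + sumR p q (λ j → Q a j)
    weight = trans (pathSum-++ Q 1 i π (downs (q ∸ p))) (cong (pathSumBefore Q 1 i π +_)
            (trans (cong₂ (λ u v → pathSum Q u v (downs (q ∸ p))) π-col π-row)
            (trans (pathSum-downs Q a p (q ∸ p)) (cong (λ z → sumR p z (λ j → Q a j)) (m+[n∸m]≡n p≤q)))))

  -- Weights of Dyck paths whose final part, from a row p > i on, is read in T instead of Q.
  ColumnBound : ℕ → Array → Set
  ColumnBound col T = ∀ p → suc i ≤ p → p ≤ n → ∀ π → endCol 1 π ≡ col → endRow i π ≡ p →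
                      pathSumBefore Q 1 i π + sumR p n (λ j → T col j) ≤ m

  PairBound : ℕ → Array → Set
  PairBound ℓ T = ∀ p → suc i ≤ p → p ≤ n → ∀ π → endCol 1 π ≡ ℓ → endRow i π ≡ p → ∀ q → p ≤ q → q ≤ n →
                  pathSumBefore Q 1 i π + W p T ℓ q ≤ m

  pairBound : ∀ ℓ T → (∀ q → T ℓ q ≡ R ℓ q) → ColumnBound (suc ℓ) T → PairBound ℓ T
  pairBound ℓ T colℓ colBound p 1+i≤p p≤n π π-col π-row q p≤q q≤n = begin
    before + (sumR p q (λ j → T ℓ j) + sumR q n (λ j → T (suc ℓ) j))
      ≤⟨ +-monoʳ-≤ before (+-monoˡ-≤ _ (sumR-mono p q (λ j _ _ → subst (_≤ Q ℓ j) (sym (colℓ j)) (R≤Q ℓ j)))) ⟩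
    before + (sumR p q (λ j → Q ℓ j) + sumR q n (λ j → T (suc ℓ) j))
      ≡⟨ sym (+-assoc before _ _) ⟩
    before + sumR p q (λ j → Q ℓ j) + sumR q n (λ j → T (suc ℓ) j)
      ≡⟨ cong (_+ sumR q n (λ j → T (suc ℓ) j)) (sym (trans (pathSumBefore-snoc Q 1 i D.path right) D.weight)) ⟩
    pathSumBefore Q 1 i (D.path ++ [ right ]) + sumR q n (λ j → T (suc ℓ) j)
      ≤⟨ colBound q (≤-trans 1+i≤p p≤q) q≤n (D.path ++ [ right ]) col′ row′ ⟩
    m ∎
    where
    open ≤-Reasoning
    before = pathSumBefore Q 1 i π
    module D = Descend {π} π-col π-row p≤q
    col′ : endCol 1 (D.path ++ [ right ]) ≡ suc ℓ
    col′ = trans (endCol-++ 1 D.path [ right ]) (cong suc D.col)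
    row′ : endRow i (D.path ++ [ right ]) ≡ q
    row′ = trans (endRow-++ i D.path [ right ]) D.row

  columnBound-R : ColumnBound i R
  columnBound-R p 1+i≤p p≤n π π-col π-row = begin
    pathSumBefore Q 1 i π + sumR p n (λ j → R i j) ≤⟨ +-monoʳ-≤ _ (sumR-mono p n (λ j _ _ → R≤Q i j)) ⟩
    pathSumBefore Q 1 i π + sumR p n (λ j → Q i j) ≡⟨ sym D.weight ⟩
    pathSum Q 1 i D.path                           ≤⟨ proj₂ Q∈B D.path (D.col , D.row) ⟩
    m ∎
    where
    open ≤-Reasoning
    module D = Descend {π} π-col π-row p≤n

  TailZero : Array → Set
  TailZero T = ∀ p q → suc i ≤ q → q ≤ k → T p q ≡ 0

  record Inv (L : ℕ) (T : Array) : Set where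
    field
      agrees    : ∀ p q → p ≤ L → T p q ≡ R p q
      tail-zero : TailZero T
      column    : ColumnBound (suc L) T

  tailZero-sum : ∀ {T} → TailZero T → ∀ col {a b} → suc i ≤ a → b ≤ k → sumR a b (λ j → T col j) ≡ 0
  tailZero-sum vanish col {a} {b} 1+i≤a b≤k = sumR-zero a b (λ j a≤j j≤b → vanish col j (≤-trans 1+i≤a a≤j) (≤-trans j≤b b≤k))

  alongRow : ℕ → List Step
  alongRow L = downs (k ∸ i) ++ rights (L ∸ 1)

  alongRow-col : ∀ L → 1 ≤ L → endCol 1 (alongRow L) ≡ L
  alongRow-col L 1≤L = trans (endCol-++ 1 (downs (k ∸ i)) (rights (L ∸ 1)))
    (trans (cong (λ a → endCol a (rights (L ∸ 1))) (endCol-downs 1 (k ∸ i))) (trans (endCol-rights 1 (L ∸ 1)) (m+[n∸m]≡n 1≤L)))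

  alongRow-row : ∀ L → endRow i (alongRow L) ≡ k
  alongRow-row L = trans (endRow-++ i (downs (k ∸ i)) (rights (L ∸ 1)))
    (trans (cong (λ b → endRow b (rights (L ∸ 1))) (trans (endRow-downs i (k ∸ i)) (m+[n∸m]≡n i≤k))) (endRow-rights k (L ∸ 1)))

  alongRow-weight : ∀ L → 1 ≤ L → pathSum Q 1 i (alongRow L) ≡ C L
  alongRow-weight L 1≤L = begin
    pathSum Q 1 i (downs (k ∸ i) ++ rights (L ∸ 1))
      ≡⟨ pathSum-++ Q 1 i (downs (k ∸ i)) (rights (L ∸ 1)) ⟩
    pathSumBefore Q 1 i (downs (k ∸ i)) + pathSum Q (endCol 1 (downs (k ∸ i))) (endRow i (downs (k ∸ i))) (rights (L ∸ 1))
      ≡⟨ cong₂ _+_ (pathSumBefore-downs-zero Q 1 i (k ∸ i) (λ j i≤j j<k → Q-above 1 j i≤j (subst (j <_) (m+[n∸m]≡n i≤k) j<k)))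
                   (cong₂ (λ a b → pathSum Q a b (rights (L ∸ 1))) (endCol-downs 1 (k ∸ i)) (trans (endRow-downs i (k ∸ i)) (m+[n∸m]≡n i≤k))) ⟩
    pathSum Q 1 k (rights (L ∸ 1))
      ≡⟨ trans (pathSum-rights Q 1 k (L ∸ 1)) (cong (λ z → sumR 1 z c) (m+[n∸m]≡n 1≤L)) ⟩
    C L ∎
    where open ≡-Reasoning

  C-mono : ∀ {L L′} → L ≤ L′ → C L ≤ C L′
  C-mono {L} {L′} L≤L′ = subst (C L ≤_) (sym (sumR-split c (s≤s z≤n) L≤L′)) (m≤m+n _ _)

  R-tail-zero : TailZero R
  R-tail-zero p q 1+i≤q q≤k = R-above p q (≤-trans (n≤1+n i) 1+i≤q) q≤k

  C+tailSum≤m : C i + tailSum R i ≤ m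
  C+tailSum≤m with m≤n⇒m<n∨m≡n k≤n
  ... | inj₂ refl = begin
    C i + tailSum R i  ≡⟨ cong (C i +_) (tailZero-sum R-tail-zero i ≤-refl ≤-refl) ⟩
    C i + 0            ≡⟨ +-identityʳ (C i) ⟩
    C i                ≡⟨ sym (alongRow-weight i 1≤i) ⟩
    pathSum Q 1 i (alongRow i) ≤⟨ proj₂ Q∈B (alongRow i) (alongRow-col i 1≤i , alongRow-row i) ⟩
    m ∎
    where open ≤-Reasoning
  ... | inj₁ k<n = begin
    C i + tailSum R i
      ≡⟨ cong₂ _+_ (sym (trans (pathSumBefore-snoc Q 1 i (alongRow i) down) (alongRow-weight i 1≤i))) below-k ⟩
    pathSumBefore Q 1 i (alongRow i ++ [ down ]) + sumR (suc k) n (λ j → R i j)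
      ≤⟨ columnBound-R (suc k) (s≤s i≤k) k<n (alongRow i ++ [ down ]) (trans (endCol-++ 1 (alongRow i) [ down ]) (alongRow-col i 1≤i))
                       (trans (endRow-++ i (alongRow i) [ down ]) (cong suc (alongRow-row i))) ⟩
    m ∎
    where
    open ≤-Reasoning
    below-k : tailSum R i ≡ sumR (suc k) n (λ j → R i j)
    below-k = trans (sumR-split (λ j → R i j) (s≤s i≤k) k≤n)
                    (cong (_+ sumR (suc k) n (λ j → R i j)) (tailZero-sum R-tail-zero i ≤-refl ≤-refl))

  C≤m : ∀ {L} → L ≤ i → C L ≤ m
  C≤m L≤i = ≤-trans (C-mono L≤i) (m+n≤o⇒m≤o (C i) C+tailSum≤m)

  W-beyond-k : ∀ {T} → TailZero T → ∀ ℓ {q} → suc k ≤ q → W (suc i) T ℓ q ≡ W (suc k) T ℓ q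
  W-beyond-k {T} vanish ℓ {q} 1+k≤q = begin
    sumR (suc i) q (λ j → T ℓ j) + sumR q n (λ j → T (suc ℓ) j)
      ≡⟨ cong (_+ sumR q n (λ j → T (suc ℓ) j)) (sumR-split (λ j → T ℓ j) (s≤s i≤k) (≤-trans (n≤1+n k) 1+k≤q)) ⟩
    sumR (suc i) k (λ j → T ℓ j) + sumR (suc k) q (λ j → T ℓ j) + sumR q n (λ j → T (suc ℓ) j)
      ≡⟨ cong (λ v → v + sumR (suc k) q (λ j → T ℓ j) + sumR q n (λ j → T (suc ℓ) j)) (tailZero-sum vanish ℓ ≤-refl ≤-refl) ⟩
    W (suc k) T ℓ q ∎
    where open ≡-Reasoning

  W-within-k : ∀ {T} → TailZero T → ∀ ℓ {q} → suc i ≤ q → q ≤ k → W (suc i) T ℓ q ≡ sumR (suc k) n (λ j → T (suc ℓ) j)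
  W-within-k {T} vanish ℓ {q} 1+i≤q q≤k = cong₂ _+_ (tailZero-sum vanish ℓ ≤-refl q≤k)
    (trans (sumR-split (λ j → T (suc ℓ) j) (m≤n⇒m≤1+n q≤k) k≤n)
           (cong (_+ sumR (suc k) n (λ j → T (suc ℓ) j)) (tailZero-sum vanish (suc ℓ) 1+i≤q ≤-refl)))

  bound : ∀ L T → t ≤ L → L < i → Inv L T → tailMax T L + C L ≤ m
  bound L T t≤L L<i inv = m≤o∸n⇒m+n≤o (tailMax T L) (C≤m (<⇒≤ L<i)) (maxR-lub (W (suc i) T L) each)
    where
    open Inv inv
    each : ∀ q → suc i ≤ q → q ≤ n → W (suc i) T L q ≤ m ∸ C L
    each q 1+i≤q q≤n with m≤n⇒m<n∨m≡n k≤n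
    ... | inj₂ refl =
      subst (_≤ m ∸ C L) (sym (trans (W-within-k tail-zero L 1+i≤q q≤n) (sumR-empty {suc k} {k} (λ j → T (suc L) j) ≤-refl))) z≤n
    ... | inj₁ k<n = W≤ (suc k ≤? q)
      where
      1≤L : 1 ≤ L
      1≤L = ≤-trans (proj₁ first-col) t≤L
      π : List Step
      π = alongRow L ++ [ down ]
      through-row-k : ∀ q → suc k ≤ q → q ≤ n → W (suc k) T L q ≤ m ∸ C L
      through-row-k q 1+k≤q q≤n = m+n≤o⇒m≤o∸n (W (suc k) T L q) (subst (_≤ m) (+-comm (C L) _)
        (subst (λ v → v + W (suc k) T L q ≤ m) (trans (pathSumBefore-snoc Q 1 i (alongRow L) down) (alongRow-weight L 1≤L))
          (pairBound L T (λ q → agrees L q ≤-refl) column (suc k) (s≤s i≤k) k<n π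
                     (trans (endCol-++ 1 (alongRow L) [ down ]) (alongRow-col L 1≤L))
                     (trans (endRow-++ i (alongRow L) [ down ]) (cong suc (alongRow-row L))) q 1+k≤q q≤n)))
      W≤ : Dec (suc k ≤ q) → W (suc i) T L q ≤ m ∸ C L
      W≤ (yes 1+k≤q) = subst (_≤ m ∸ C L) (sym (W-beyond-k tail-zero L 1+k≤q)) (through-row-k q 1+k≤q q≤n)
      W≤ (no 1+k≰q)  = ≤-trans (≤-reflexive (W-within-k tail-zero L 1+i≤q (≤-pred (≰⇒> 1+k≰q))))
                         (≤-trans (m≤n+m _ _) (through-row-k (suc k) ≤-refl k<n))

  module TailStepBound (i<n : i < n) (T : Array) (ℓ : ℕ) (unsat : tailSum T ℓ < tailMax T ℓ)
                       (vanish : TailZero T) (pb : PairBound ℓ T) where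
    open TailStep i<n T ℓ unsat
    private
      T′ : Array
      T′ = tailLeft ℓ T

    k<P : k < P
    k<P with k <? P
    ... | yes k<P = k<P
    ... | no k≮P  = ⊥-elim (<-irrefl (sym (vanish (suc ℓ) P 1+i≤P (≮⇒≥ k≮P))) source-pos)

    unchanged : ∀ c {q} → q ≢ P → T′ c q ≡ T c q
    unchanged c = moveLeft-row ℓ P T c

    tail-zero′ : TailZero T′
    tail-zero′ p q 1+i≤q q≤k = trans (unchanged p (<⇒≢ (≤-<-trans q≤k k<P))) (vanish p q 1+i≤q q≤k)

    pairBound′ : PairBound ℓ T′
    pairBound′ p 1+i≤p p≤n π π-col π-row q p≤q q≤n with p ≤? P
    ... | no p≰P = subst (λ v → pathSumBefore Q 1 i π + v ≤ m) (sym same) (pb p 1+i≤p p≤n π π-col π-row q p≤q q≤n)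
      where
      P<p : P < p
      P<p = ≰⇒> p≰P
      same : W p T′ ℓ q ≡ W p T ℓ q
      same = cong₂ _+_ (sumR-cong p q (λ j p≤j _ → unchanged ℓ (>⇒≢ (<-≤-trans P<p p≤j))))
                       (sumR-cong q n (λ j q≤j _ → unchanged (suc ℓ) (>⇒≢ (<-≤-trans P<p (≤-trans p≤q q≤j)))))
    ... | yes p≤P with <-cmp q P
    ...   | tri< q<P _ _ = ≤-trans (+-monoʳ-≤ (pathSumBefore Q 1 i π) (≤-trans (n≤1+n _) (≤-reflexive (M.W-before q<P))))
                                   (pb p 1+i≤p p≤n π π-col π-row q p≤q q≤n)
      where module M = MoveLeft T ℓ p≤P P≤n source-pos
    ...   | tri≈ _ refl _ = subst (λ v → pathSumBefore Q 1 i π + v ≤ m) (sym M.W-at) (pb p 1+i≤p p≤n π π-col π-row q p≤q q≤n)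
      where module M = MoveLeft T ℓ p≤P P≤n source-pos
    ...   | tri> _ _ P<q = ≤-trans (+-monoʳ-≤ (pathSumBefore Q 1 i π) (subst (_≤ W p T ℓ P) (sym (M.W-after P<q)) strict))
                                   (pb p 1+i≤p p≤n π π-col π-row P p≤P P≤n)
      where
      module M = MoveLeft T ℓ p≤P P≤n source-pos
      strict : W p T ℓ q < W p T ℓ P
      strict = +-cancelˡ-< (sumR (suc i) (p ∸ 1) (λ j → T ℓ j)) _ _
        (subst₂ _<_ (W-split T ℓ 1≤p 1+i≤p p≤q) (W-split T ℓ 1≤p 1+i≤p p≤P) (IsLastMax.beyond P-lastMax q P<q q≤n))
        where
        1≤p : 1 ≤ p
        1≤p = ≤-trans (s≤s z≤n) 1+i≤p

  record Kept (L : ℕ) (T T′ : Array) : Set where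
    field
      left      : ∀ p q → p ≤ L → T′ p q ≡ T p q
      tail-zero : TailZero T′
      pair      : PairBound (suc L) T′

  preserved : ∀ L T → Inv (suc L) T → Inv L ((tailLeft (suc L) ^ (tailMax T (suc L) ∸ tailSum T (suc L))) T)
  preserved L T inv with m≤n⇒m<n∨m≡n i≤n
  ... | inj₂ i≡n rewrite tailMax-empty i≡n T (suc L) | tailSum-empty i≡n T (suc L) = record
    { agrees    = λ p q p≤L → agrees p q (m≤n⇒m≤1+n p≤L)
    ; tail-zero = tail-zero
    ; column    = λ p 1+i≤p p≤n → ⊥-elim (<⇒≱ 1+i≤p (subst (p ≤_) (sym i≡n) p≤n))
    }
    where open Inv inv
  ... | inj₁ i<n = record
    { agrees    = λ p q p≤L → trans (Kept.left final p q p≤L) (agrees p q (m≤n⇒m≤1+n p≤L))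
    ; tail-zero = Kept.tail-zero final
    ; column    = λ p 1+i≤p p≤n π π-col π-row →
                    ≤-trans (+-monoʳ-≤ (pathSumBefore Q 1 i π) (m≤m+n _ _)) (Kept.pair final p 1+i≤p p≤n π π-col π-row n p≤n ≤-refl)
    }
    where
    open Inv inv
    ℓ : ℕ
    ℓ = suc L
    a : ℕ
    a = tailMax T ℓ ∸ tailSum T ℓ
    keep : ∀ j → j ≤ a → Kept L T ((tailLeft ℓ ^ j) T)
    keep zero    _      = record { left = λ p q _ → refl ; tail-zero = tail-zero ; pair = pairBound ℓ T (λ q → agrees ℓ q ≤-refl) column }
    keep (suc j) 1+j≤a  = record
      { left      = λ p q p≤L → trans (moveLeft-col ℓ (tailLast Tj ℓ) Tj q (<⇒≢ (s≤s p≤L)) (<⇒≢ (m<n⇒m<1+n (s≤s p≤L))))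
                                      (left p q p≤L)
      ; tail-zero = B.tail-zero′
      ; pair      = B.pairBound′
      }
      where
      open Kept (keep j (≤-trans (n≤1+n j) 1+j≤a)) renaming (tail-zero to tail-zero-j)
      Tj : Array
      Tj = (tailLeft ℓ ^ j) T
      room : tailSum T ℓ + suc j ≤ tailMax T ℓ
      room = ≤-trans (+-monoʳ-≤ (tailSum T ℓ) 1+j≤a) (≤-reflexive (m+[n∸m]≡n (tailSum≤tailMax T ℓ)))
      module B = TailStepBound i<n Tj ℓ (unsaturated i<n T ℓ j room) tail-zero-j pair
    final : Kept L T ((tailLeft ℓ ^ a) T)
    final = keep a ≤-refl

-- The operator H

transpose : Array → Array
transpose A c r = A r c

transpose-inc : ∀ a b A → transpose (inc a b A) ≈ inc b a (transpose A)
transpose-inc a b A c r = cong (λ β → if β then suc (A r c) else A r c) (∧-comm (a ≡ᵇ r) (b ≡ᵇ c))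

transpose-dec : ∀ a b A → transpose (dec a b A) ≈ dec b a (transpose A)
transpose-dec a b A c r = cong (λ β → if β then A r c ∸ 1 else A r c) (∧-comm (a ≡ᵇ r) (b ≡ᵇ c))

-- For ℓ > i the operator f_ℓ is, after transposition, a move to the right between the adjacent
-- columns ℓ − 1 and ℓ at the first maximiser: everything is read off the column-pair lemmas with n := i.
module Descent (n i m : ℕ) (1≤i : 1 ≤ i) where
  open Crystal n i m
  open Operators n i m
  open ColumnPair i

  W-cong : ∀ {A A′} → A ≈ A′ → ∀ lo ℓ q → W lo A ℓ q ≡ W lo A′ ℓ q
  W-cong A≈A′ lo ℓ q = cong₂ _+_ (sumR-cong lo q (λ j _ _ → A≈A′ ℓ j)) (sumR-cong q i (λ j _ _ → A≈A′ (suc ℓ) j))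

  module AboveHead {ℓ′ : ℕ} (i≤ℓ′ : i ≤ ℓ′) where
    ℓ : ℕ
    ℓ = suc ℓ′

    p₊-firstMax : ∀ A → IsFirstMax (W 1 (transpose A) ℓ′) 1 i (p₊ A ℓ)
    p₊-firstMax A = smallestMax-correct (W 1 (transpose A) ℓ′) 1≤i

    φ-value : ∀ A → φ ℓ A + sumR 1 i (λ j → A j ℓ) ≡ W 1 (transpose A) ℓ′ (p₊ A ℓ)
    φ-value A rewrite Above.φ≡ (s≤s i≤ℓ′) A =
      ε-formula (transpose A) ℓ′ ≤-refl lower upper (≤-trans (m≤n+m _ _) (maximal 1 ≤-refl 1≤i))
      where open IsFirstMax (p₊-firstMax A)

    transpose-fMove : ∀ A → transpose (fMove ℓ A) ≈ moveRight ℓ′ (p₊ A ℓ) (transpose A)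
    transpose-fMove A rewrite Above.fMove≡ (s≤s i≤ℓ′) A =
      ≈-trans (transpose-inc (p₊ A ℓ) ℓ (dec (p₊ A ℓ) ℓ′ A)) (inc-cong ℓ (p₊ A ℓ) (transpose-dec (p₊ A ℓ) ℓ′ A))

    module Move (A : Array) (0<φ : 0 < φ ℓ A) where
      p = p₊ A ℓ
      open IsFirstMax (p₊-firstMax A) public using () renaming (lower to 1≤p; upper to p≤i)

      source-pos : 0 < A p ℓ′
      source-pos = firstMax-source-pos (transpose A) ℓ′ (p₊-firstMax A)
        (subst (sumR 1 i (λ j → A j ℓ) <_) (φ-value A) (+-monoˡ-≤ (sumR 1 i (λ j → A j ℓ)) 0<φ))

      private
        B : Array
        B = fMove ℓ A
        module M = MoveRight (transpose A) ℓ′ 1≤p p≤i source-pos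
        B≡ : ∀ x q → B x q ≡ moveRight ℓ′ p (transpose A) q x
        B≡ x q = transpose-fMove A q x

      from : B p ℓ′ ≡ A p ℓ′ ∸ 1
      from = trans (B≡ p ℓ′) (moveRight-from ℓ′ p (transpose A))

      to : B p ℓ ≡ suc (A p ℓ)
      to = trans (B≡ p ℓ) (moveRight-to ℓ′ p (transpose A))

      off-column : ∀ {x} q → x ≢ p → B x q ≡ A x q
      off-column q x≢p = trans (B≡ _ q) (moveRight-row ℓ′ p (transpose A) q x≢p)

      off-rows : ∀ x {q} → q ≢ ℓ′ → q ≢ ℓ → B x q ≡ A x q
      off-rows x q≢ℓ′ q≢ℓ = trans (B≡ x _) (moveRight-col ℓ′ p (transpose A) x q≢ℓ′ q≢ℓ)

      row-shrinks : suc (sumR 1 i (λ j → B j ℓ′)) ≡ sumR 1 i (λ j → A j ℓ′)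
      row-shrinks = trans (cong suc (sumR-cong 1 i (λ j _ _ → B≡ j ℓ′))) (M.rowℓ-shrinks 1≤p p≤i)

      φ-drops : suc (φ ℓ B) ≡ φ ℓ A
      φ-drops = +-cancelʳ-≡ (sumR 1 i (λ j → A j ℓ)) _ _ (begin
        suc (φ ℓ B) + sumR 1 i (λ j → A j ℓ)      ≡⟨ sym (+-suc (φ ℓ B) _) ⟩
        φ ℓ B + suc (sumR 1 i (λ j → A j ℓ))      ≡⟨ cong (φ ℓ B +_) (sym row-grows) ⟩
        φ ℓ B + sumR 1 i (λ j → B j ℓ)            ≡⟨ φ-value B ⟩
        W 1 (transpose B) ℓ′ (p₊ B ℓ)             ≡⟨ sym (lastMax-firstMax-value still-last (p₊-firstMax B)) ⟩
        W 1 (transpose B) ℓ′ p                     ≡⟨ trans (W-cong (transpose-fMove A) 1 ℓ′ p) M.W-at ⟩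
        W 1 (transpose A) ℓ′ p                     ≡⟨ sym (φ-value A) ⟩
        φ ℓ A + sumR 1 i (λ j → A j ℓ)            ∎)
        where
        open ≡-Reasoning
        row-grows : sumR 1 i (λ j → B j ℓ) ≡ suc (sumR 1 i (λ j → A j ℓ))
        row-grows = trans (sumR-cong 1 i (λ j _ _ → transpose-fMove A ℓ j)) (M.rowℓ+1-grows 1≤p p≤i)
        still-last : IsLastMax (W 1 (transpose B) ℓ′) 1 i p
        still-last = IsLastMax-resp (λ q _ _ → sym (W-cong (transpose-fMove A) 1 ℓ′ q)) (M.firstMax⇒lastMax (p₊-firstMax A))

  module ShiftRow {ℓ′ : ℕ} (i≤ℓ′ : i ≤ ℓ′) (R : Array) (c : ℕ → ℕ)
                  (R-empty : ∀ p → R p ℓ′ ≡ 0) (R-next-empty : ∀ p → R p (suc ℓ′) ≡ 0)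
                  (c-outside : ∀ p → (p ≡ 0 ⊎ i < p) → c p ≡ 0) where
    open AboveHead i≤ℓ′
    private
      total : ℕ
      total = sumR 1 i c
      A₀ : Array
      A₀ = setRow R ℓ′ c
      S : ℕ → Array
      S j = (fMove ℓ ^ j) A₀

    record Shifted (j : ℕ) (A : Array) : Set where
      field
        φ-left   : φ ℓ A + j ≡ total
        row-left : sumR 1 i (λ p → A p ℓ′) + j ≡ total
        pair     : ∀ p → A p ℓ′ + A p ℓ ≡ c p
        rest     : ∀ p q → q ≢ ℓ′ → q ≢ ℓ → A p q ≡ R p q
        outside  : ∀ p → (p ≡ 0 ⊎ i < p) → A p ℓ′ ≡ c p

    private
      A₀-row : ∀ p → A₀ p ℓ′ ≡ c p
      A₀-row = setRow-at R ℓ′ c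
      A₀-next : ∀ p → A₀ p ℓ ≡ 0
      A₀-next p = trans (setRow-off R c p 1+n≢n) (R-next-empty p)

    φ-start : φ ℓ A₀ ≡ total
    φ-start = begin
      φ ℓ A₀                                  ≡⟨ sym (+-identityʳ _) ⟩
      φ ℓ A₀ + 0                              ≡⟨ cong (φ ℓ A₀ +_) (sym (sumR-zero 1 i (λ j _ _ → A₀-next j))) ⟩
      φ ℓ A₀ + sumR 1 i (λ j → A₀ j ℓ)        ≡⟨ φ-value A₀ ⟩
      W 1 (transpose A₀) ℓ′ (p₊ A₀ ℓ)         ≡⟨ ≤-antisym (subst (_≤ total) (sym (W≡ (p₊ A₀ ℓ))) (C-mono upper))
                                                           (subst (_≤ W 1 (transpose A₀) ℓ′ (p₊ A₀ ℓ)) (W≡ i) (maximal i 1≤i ≤-refl)) ⟩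
      total                                   ∎
      where
      open ≡-Reasoning
      open IsFirstMax (p₊-firstMax A₀)
      W≡ : ∀ q → W 1 (transpose A₀) ℓ′ q ≡ sumR 1 q c
      W≡ q = trans (cong₂ _+_ (sumR-cong 1 q (λ j _ _ → A₀-row j)) (sumR-zero q i (λ j _ _ → A₀-next j))) (+-identityʳ _)
      C-mono : ∀ {q} → q ≤ i → sumR 1 q c ≤ total
      C-mono q≤i = subst (_ ≤_) (sym (sumR-split c (s≤s z≤n) q≤i)) (m≤m+n _ _)

    shifted₀ : Shifted 0 A₀
    shifted₀ = record
      { φ-left   = trans (+-identityʳ _) φ-start
      ; row-left = trans (+-identityʳ _) (sumR-cong 1 i (λ j _ _ → A₀-row j))
      ; pair     = λ p → trans (cong₂ _+_ (A₀-row p) (A₀-next p)) (+-identityʳ _)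
      ; rest     = λ p q q≢ℓ′ _ → setRow-off R c p q≢ℓ′
      ; outside  = λ p _ → A₀-row p
      }

    shift-step : ∀ {j A} → j < total → Shifted j A → 0 < φ ℓ A × Shifted (suc j) (fMove ℓ A)
    shift-step {j} {A} j<total sh = 0<φ , record
      { φ-left   = trans (+-suc _ j) (trans (cong (_+ j) M.φ-drops) φ-left)
      ; row-left = trans (+-suc _ j) (trans (cong (_+ j) M.row-shrinks) row-left)
      ; pair     = pair′
      ; rest     = λ p q q≢ℓ′ q≢ℓ → trans (M.off-rows p q≢ℓ′ q≢ℓ) (rest p q q≢ℓ′ q≢ℓ)
      ; outside  = λ p out → trans (M.off-column ℓ′ (away out)) (outside p out)
      }
      where
      open Shifted sh
      0<φ : 0 < φ ℓ A
      0<φ = m+n≡o∧n<o⇒0<m φ-left j<total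
      module M = Move A 0<φ
      pair′ : ∀ p → fMove ℓ A p ℓ′ + fMove ℓ A p ℓ ≡ c p
      pair′ p with p ≟ M.p
      ... | yes refl = trans (cong₂ _+_ M.from M.to) (trans (+-suc _ _) (trans (cong (_+ A p ℓ) (suc[m∸1]≡m M.source-pos)) (pair p)))
      ... | no p≢P   = trans (cong₂ _+_ (M.off-column ℓ′ p≢P) (M.off-column ℓ p≢P)) (pair p)
      away : ∀ {x} → (x ≡ 0 ⊎ i < x) → x ≢ M.p
      away (inj₁ x≡0) x≡p = <⇒≱ M.1≤p (≤-reflexive (trans (sym x≡p) x≡0))
      away (inj₂ i<x) x≡p = <⇒≱ i<x (subst (_≤ i) (sym x≡p) M.p≤i)

    shifted : ∀ j → j ≤ total → Shifted j (S j)
    shifted zero    _         = shifted₀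
    shifted (suc j) 1+j≤total = proj₂ (shift-step 1+j≤total (shifted j (≤-trans (n≤1+n j) 1+j≤total)))

    result : fMax ℓ A₀ ⇓ setRow R ℓ c
    result rewrite φ-start =
      ⇓-≈ (fPow-chain ℓ S total (λ j j<total → f-step (proj₁ (shift-step j<total (shifted j (<⇒≤ j<total)))) ≈-refl)) moved
      where
      open Shifted (shifted total ≤-refl)
      emptied : ∀ p → S total p ℓ′ ≡ 0
      emptied p with p ≟ 0 | i <? p
      ... | yes p≡0 | _       = trans (outside p (inj₁ p≡0)) (c-outside p (inj₁ p≡0))
      ... | no _    | yes i<p = trans (outside p (inj₂ i<p)) (c-outside p (inj₂ i<p))
      ... | no p≢0  | no i≮p  = sumR≡0⇒ (λ q → S total q ℓ′) (+-cancelʳ-≡ total _ 0 row-left) p (n≢0⇒n>0 p≢0) (≮⇒≥ i≮p)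
      moved : S total ≈ setRow R ℓ c
      moved p q with q ≟ ℓ | q ≟ ℓ′
      ... | yes refl | _        = trans (sym (trans (cong (_+ S total p q) (emptied p)) refl)) (trans (pair p) (sym (setRow-at R q c p)))
      ... | no _     | yes refl = trans (emptied p) (trans (sym (R-empty p)) (sym (setRow-off R c p n≢1+n)))
      ... | no q≢ℓ   | no q≢ℓ′  = trans (rest p q q≢ℓ′ q≢ℓ) (sym (setRow-off R c p q≢ℓ))

module Proof (n i′ m : ℕ) (i≤n : suc i′ ≤ n) (Q : Array) (Q∈B : InB n (suc i′) m Q) (k t : ℕ)
             (first-row : IsFirstNonzeroRow n (suc i′) Q k) (first-col : IsFirstNonzeroCol (suc i′) Q k t) where
  i : ℕ
  i = suc i′

  1≤i : 1 ≤ i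
  1≤i = s≤s z≤n

  open Crystal n i m
  open Operators n i m
  open HeadTail n i m 1≤i i≤n
  open Phases n i m 1≤i i≤n
  open PathBounds n i m 1≤i i≤n Q Q∈B k t first-row first-col
  open Composite t c (proj₁ first-col) c-before Inv bound preserved hiding (C)
  open Descent n i m 1≤i using (module ShiftRow)
  module Con = Construction n i m Q k t

  empty : ℕ → ℕ
  empty _ = 0

  R≈headless : R ≈ withHead R empty
  R≈headless p q with q ≟ i
  ... | yes refl = trans (R-above p q ≤-refl i≤k) (sym (setRow-at R q empty p))
  ... | no q≢i   = sym (setRow-off R empty p q≢i)

  -- For t = i the composite E ∘ F is just f_i^{c_i}.
  C⇓-single : t ≡ i → Con.C ⇓ withHead R c
  C⇓-single refl rewrite range-nil {suc t} {t} ≤-refl | bind-just (fPow t (c t) R) =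
    ⇓-≈ (≋-trans (fPow-resp t (c t) R≈headless) (FA.power (c t) (m+n≤o⇒m≤o∸n (c t) c-room)))
        (setRow-congʳ R t only-t)
    where
    c-room : c i + tailSum R i ≤ m
    c-room = ≤-trans (+-monoˡ-≤ (tailSum R i) (m≤sumR c 1≤i ≤-refl)) C+tailSum≤m
    module FA = FiPhase R empty (λ _ _ → refl) (m+n≤o⇒n≤o (c t) c-room)
    only-t : ∀ p → setAt empty t (c t) p ≡ c p
    only-t p with <-cmp p t
    ... | tri< p<t _ _ = trans (setAt-off empty (c t) (<⇒≢ p<t)) (sym (c-before p p<t))
    ... | tri≈ _ refl _ = setAt-at empty p (c p)
    ... | tri> _ _ t<p = trans (setAt-off empty (c t) (>⇒≢ t<p)) (sym (c-outside p (inj₂ t<p)))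

  -- For t < i: f_i^{φ_i} fills column i of the head row, the layers t, …, i − 1 follow, and e_i^{ε_i − c_i} trims column i.
  C⇓-nested : t < i → Con.C ⇓ withHead R c
  C⇓-nested (s≤s t≤i′) rewrite EF-suc i′ R t≤i′ =
    ⇓-≈ (>>=-⇓ (>>=-⇓ (≋-trans (fMax-resp i R≈headless) FA.result) (EF-resp i′) O.computes) (eLayer-resp i) EA.result)
        (setRow-congʳ R i final)
    where
    module FA = FiPhase R empty (λ _ _ → refl) (m+n≤o⇒n≤o (C i) C+tailSum≤m)
    x₁ : ℕ → ℕ
    x₁ = setAt empty i (m ∸ tailSum R i)
    inv₀ : Inv i′ R
    inv₀ = record { agrees = λ _ _ _ → refl ; tail-zero = R-tail-zero ; column = columnBound-R }
    x₁-zero : ∀ j → j ≤ i′ → x₁ j ≡ 0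
    x₁-zero j j≤i′ = setAt-off empty _ (<⇒≢ (s≤s j≤i′))
    x₁-full : x₁ i + tailSum R i ≡ m
    x₁-full = trans (cong (_+ tailSum R i) (setAt-at empty i _)) (m∸n+n≡m (m+n≤o⇒n≤o (C i) C+tailSum≤m))
    module O = Outcome (layers i′ t≤i′ ≤-refl R x₁ inv₀ x₁-zero x₁-full)
    x₂ : ℕ → ℕ
    x₂ = O.row
    c≤x₂ : c i ≤ x₂ i
    c≤x₂ = +-cancelʳ-≤ (C i′) (c i) (x₂ i)
             (subst₂ _≤_ (trans (C-suc i′) (+-comm (C i′) (c i))) (sym (trans O.next (setAt-at empty i _))) (m+n≤o⇒m≤o∸n (C i) C+tailSum≤m))
    module EA = EiPhase R x₂ (c i) c≤x₂
    final : ∀ p → setAt x₂ i (c i) p ≡ c p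
    final p with <-cmp p i
    ... | tri≈ _ refl _ = setAt-at x₂ p (c p)
    ... | tri< p<i _ _ = trans (setAt-off x₂ (c i) (<⇒≢ p<i)) (O.low p (≤-pred p<i))
    ... | tri> _ _ i<p = trans (setAt-off x₂ (c i) (>⇒≢ i<p))
                           (trans (O.high p i<p) (trans (setAt-off empty _ (>⇒≢ i<p)) (sym (c-outside p (inj₂ i<p)))))

  C⇓ : Con.C ⇓ withHead R c
  C⇓ = [ C⇓-nested , C⇓-single ]′ (m≤n⇒m<n∨m≡n (proj₁ (proj₂ first-col)))

  H⇓ : ∀ r → i ≤ r → r ≤ k → applySeq (range (suc i) r) fMax (withHead R c) ⇓ setRow R r c
  H⇓ r i≤r r≤k with m≤n⇒m<n∨m≡n i≤r
  ... | inj₂ refl rewrite range-nil (n<1+n r) = just ≈-refl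
  H⇓ (suc r) _ 1+r≤k | inj₁ (s≤s i≤r)
    rewrite range-snoc (s≤s i≤r) | applySeq-++ (range (suc i) r) [ suc r ] fMax (withHead R c) =
      >>=-⇓ (H⇓ r i≤r (≤-trans (n≤1+n r) 1+r≤k)) (applySeq-resp [ suc r ] fMax fMax-resp) one-more
    where
    module S = ShiftRow i≤r R c (λ p → R-above p r i≤r (≤-trans (n≤1+n r) 1+r≤k))
                                (λ p → R-above p (suc r) (m≤n⇒m≤1+n i≤r) 1+r≤k) c-outside
    one-more : applySeq [ suc r ] fMax (setRow R r c) ⇓ setRow R (suc r) c
    one-more rewrite bind-just (fMax (suc r) (setRow R r c)) = S.result

  result : (Con.C >>= Con.H) ⇓ Q
  result = >>=-⇓ C⇓ (applySeq-resp (range (suc i) k) fMax fMax-resp) (⇓-≈ (H⇓ k i≤k ≤-refl) row-k-restored)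
    where
    row-k-restored : setRow R k c ≈ Q
    row-k-restored p q with q ≟ k
    ... | yes refl = setRow-at R q c p
    ... | no q≢k   = trans (setRow-off R c p q≢k) (R-off p q≢k)

lemma3p8 : (n i m : ℕ) → 2 ≤ n → 2 ≤ i → i ≤ n → 1 ≤ m →
    (Q : Array) → InB n i m Q →
    (k t : ℕ) → IsFirstNonzeroRow n i Q k → IsFirstNonzeroCol i Q k t →
    Σ Array (λ A →
      ((Construction.C n i m Q k t >>= Construction.H n i m Q k t) ≡ just A) ×
      (∀ p q → A p q ≡ Q p q))
lemma3p8 n (suc i′) m _ _ i≤n _ Q Q∈B k t first-row first-col = ⇓⇒≡just (Proof.result n i′ m i≤n Q Q∈B k t first-row first-col)
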